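{- Let $a\in\mathfrak h$ with $\langle a,a\rangle=1$, and let $r,t$ be odd integers with $t\ge1$ and $r\ge3$. Then $v_{r,t}:=(r-1)!\,a[-r]a[-1]^t\mathbf{1}$ satisfies $$v_{r,t}=\sum_{n\ge0}\sum_{k\ge0}\binom{t}{2k}\frac{n!\,S_r^{(n+1)}(2k)!}{k!(-24)^k}\,a(-n-1)a(-1)^{t-2k}\mathbf{1}-\sum_{k\ge0}\binom{t}{2k+1}\frac{B_{r+1}(2k+1)!}{k!(r+1)(-24)^k}\,a(-1)^{t-2k-1}\mathbf{1}.$$
   Context: $\Lambda$ is an even unimodular lattice of rank $d$ with bilinear form $\langle\cdot,\cdot\rangle$, $\mathfrak h=\Lambda\otimes_{\mathbb{Z}}\mathbb{C}$. $V_\Lambda=S_{\mathrm{alg}}\otimes\mathbb{C}\{\Lambda\}$ is the lattice vertex operator algebra: $S_{\mathrm{alg}}$ is the Heisenberg Fock space with operators $b(n)$ ($b\in\mathfrak h$, $n\in\mathbb Z$), $[b(m),c(n)]=m\langle b,c\rangle\delta_{m+n,0}$, $b(n)$ for $n>0$ annihilating the vacuum $\mathbf{1}$ and $b(n)$, $n<0$, acting as creation operators; $\mathbb{C}\{\Lambda\}$ has basis $e^\alpha$, $b(n)$ for $n\ne0$ acts on the first factor and $b(0)(u\otimes e^\alpha)=\langle b,\alpha\rangle u\otimes e^\alpha$; $\mathbf{1}=\mathbf 1\otimes e^0$. The square-bracket modes of $a$ are $a[n]=\mathrm{Res}_z\,z^ne^z\sum_{m\in\mathbb Z}a(m)(e^z-1)^{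 -m-1}$ with $(e^z-1)^{ -m-1}$ expanded as a Laurent series in $z$. $S_r^{(n+1)}=\frac1{n!}\sum_{j\ge0}\binom nj(-1)^{n+j}(j+1)^{r-1}$ and $B_m$ are the Bernoulli numbers. -}

module Defs where

open import Data.Nat as ℕ using (ℕ; zero; suc; _!; _∸_)
open import Data.Nat.Combinatorics using (_C_)
open import Data.Integer as ℤ using (ℤ; +_; -[1+_])
open import Data.Rational as ℚ using (ℚ; 0ℚ; 1ℚ; _+_; _*_; -_; _-_)
open import Data.List as L using (List; []; _∷_; _++_; length)
open import Data.Product using (_×_; _,_)
open import Data.Bool using (Bool; true; false; _∧_; if_then_else_)

ℕ→ℚ : ℕ → ℚ
ℕ→ℚ n = (+ n) ℚ./ 1

ℤ→ℚ : ℤ → ℚ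
ℤ→ℚ z = z ℚ./ 1

-- reciprocal of a natural number (value at 0 is irrelevant; only used on
-- nonzero arguments such as factorials)
inv : ℕ → ℚ
inv zero    = 0ℚ
inv (suc n) = (+ 1) ℚ./ (suc n)

_^q_ : ℚ → ℕ → ℚ
q ^q zero  = 1ℚ
q ^q suc n = q * (q ^q n)

sumTo : ℕ → (ℕ → ℚ) → ℚ
sumTo zero    f = f 0
sumTo (suc n) f = sumTo n f + f (suc n)

PS : Set
PS = ℕ → ℚ

psMul : PS → PS → PS
psMul p q k = sumTo k (λ j → p j * q (k ∸ j))

psPow : PS → ℕ → PS
psPow p zero    = λ { zero → 1ℚ ; (suc _) → 0ℚ }
psPow p (suc n) = psMul p (psPow p n)

expPS : PS
expPS k = inv (k !)

-- f(z) = (e^z - 1)/z = Σ z^k/(k+1)!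
fPS : PS
fPS k = inv (suc k !)

-- g = 1/f = z/(e^z - 1).  gRev k = [g_k, g_{k-1}, …, g_0], with
-- g_0 = 1 and g_{k+1} = - Σ_{j=1}^{k+1} f_j g_{k+1-j}.
gRev : ℕ → List ℚ
gRev zero    = 1ℚ ∷ []
gRev (suc k) = (- sumZ 1 (gRev k)) ∷ gRev k
  where
  sumZ : ℕ → List ℚ → ℚ
  sumZ j []       = 0ℚ
  sumZ j (x ∷ xs) = fPS j * x + sumZ (suc j) xs

gPS : PS
gPS k with gRev k
... | []    = 0ℚ
... | x ∷ _ = x

-- Bernoulli numbers: z/(e^z-1) = Σ B_m z^m/m!
bernoulli : ℕ → ℚ
bernoulli m = ℕ→ℚ (m !) * gPS m

-- Res_z z^n e^z (e^z-1)^{-m-1}, for integers n, m.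
-- Since e^z-1 = z f(z), this is z^{n-m-1} e^z f(z)^{-m-1}, whose residue
-- is the coefficient of z^{m-n} in e^z f(z)^{-m-1} (zero if m < n).
resCoeff : ℤ → ℤ → ℚ
resCoeff n m with m ℤ.- n
... | -[1+ _ ] = 0ℚ
... | + d with m
...   | + j          = psMul expPS (psPow gPS (suc j)) d   -- m = j ≥ 0 : f^{-(j+1)}
...   | -[1+ zero ]  = expPS d                              -- m = -1    : f^0
...   | -[1+ suc i ] = psMul expPS (psPow fPS (suc i)) d   -- m = -(i+2): f^{i+1}

-- The Heisenberg Fock space of the rank-one Heisenberg algebra generated
-- by a with <a,a> = 1, realised as ℚ[x₁,x₂,…] (x_n ↔ a(-n)), vacuum = 1.
-- A monomial is a list of exponents [e₁, e₂, …] (missing entries = 0);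
-- a vector is a formal ℚ-linear combination of monomials.

Mono : Set
Mono = List ℕ

Fock : Set
Fock = List (ℚ × Mono)

vac : Fock
vac = (1ℚ , []) ∷ []

-- monomials equal up to trailing zeros
isZero : ℕ → Bool
isZero zero    = true
isZero (suc _) = false

eqℕ : ℕ → ℕ → Bool
eqℕ zero    zero    = true
eqℕ (suc m) (suc n) = eqℕ m n
eqℕ _       _       = false

allZero : Mono → Bool
allZero []       = true
allZero (e ∷ es) = isZero e ∧ allZero es

eqMono : Mono → Mono → Bool
eqMono []       ν        = allZero ν
eqMono (e ∷ μ)  []       = allZero (e ∷ μ)
eqMono (e ∷ μ)  (f ∷ ν)  = eqℕ e f ∧ eqMono μ ν

coeff : Fock → Mono → ℚ
coeff []             μ = 0ℚ
coeff ((c , ν) ∷ v)  μ = (if eqMono ν μ then c else 0ℚ) + coeff v μ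

scale : ℚ → Fock → Fock
scale q v = L.map (λ { (c , ν) → (q * c , ν) }) v

-- exponent of x_{i+1}
expAt : ℕ → Mono → ℕ
expAt i       []      = 0
expAt zero    (e ∷ _) = e
expAt (suc i) (_ ∷ μ) = expAt i μ

incAt : ℕ → Mono → Mono
incAt zero    []      = 1 ∷ []
incAt (suc i) []      = 0 ∷ incAt i []
incAt zero    (e ∷ μ) = suc e ∷ μ
incAt (suc i) (e ∷ μ) = e ∷ incAt i μ

decAt : ℕ → Mono → Mono
decAt i       []      = []
decAt zero    (e ∷ μ) = (e ∸ 1) ∷ μ
decAt (suc i) (e ∷ μ) = e ∷ decAt i μ

-- a(-(i+1)) : multiplication by x_{i+1}
creat : ℕ → Fock → Fock
creat i v = L.map (λ { (c , ν) → (c , incAt i ν) }) v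

-- a(i+1) = (i+1) ∂/∂x_{i+1}
annih : ℕ → Fock → Fock
annih i []            = []
annih i ((c , ν) ∷ v) =
  (ℕ→ℚ (suc i) * ℕ→ℚ (expAt i ν) * c , decAt i ν) ∷ annih i v

-- the Heisenberg mode a(m), m ∈ ℤ  (a(0) acts by <a,0> = 0 on this space)
mode : ℤ → Fock → Fock
mode (+ zero)    v = []
mode (+ suc i)   v = annih i v
mode -[1+ i ]    v = creat i v

a-1^ : ℕ → Fock → Fock
a-1^ zero    v = v
a-1^ (suc k) v = mode (ℤ.- (+ 1)) (a-1^ k v)

-- largest length of a monomial occurring in v: a(m) v = 0 for m > maxLen v
maxLen : Fock → ℕ
maxLen []            = 0
maxLen ((_ , ν) ∷ v) = length ν ℕ.⊔ maxLen v

-- a[n] v = Res_z z^n e^z Σ_m a(m) v (e^z-1)^{-m-1}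
--        = Σ_{m = n}^{maxLen v} resCoeff n m · a(m) v
-- (terms with m < n have zero residue; terms with m > maxLen v vanish).
sqMode : ℤ → Fock → Fock
sqMode n v = go (ℤ.∣ (+ maxLen v) ℤ.- n ∣) 
  where
  go : ℕ → Fock
  go zero    = scale (resCoeff n n) (mode n v)
  go (suc k) = go k ++ scale (resCoeff n (n ℤ.+ + suc k)) (mode (n ℤ.+ + suc k) v)

sqA-1^ : ℕ → Fock
sqA-1^ zero    = vac
sqA-1^ (suc t) = sqMode (ℤ.- (+ 1)) (sqA-1^ t)

stirling : ℕ → ℕ → ℚ
stirling r n =
  inv (n !) * sumTo n (λ j → ℕ→ℚ (n C j) * ((- 1ℚ) ^q (n ℕ.+ j)) * ℕ→ℚ ((suc j) ℕ.^ (r ∸ 1)))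

vrt : ℕ → ℕ → Fock
vrt r t = scale (ℕ→ℚ ((r ∸ 1) !)) (sqMode (ℤ.- (+ r)) (sqA-1^ t))

-- The sum over n ≥ 0
-- is evaluated coefficientwise: for n ≥ length μ the vector
-- a(-n-1) a(-1)^{t-2k} 1 has zero μ-coefficient, so the sum over
-- n ≤ length μ is the full (formally infinite) sum.  The sums over k run
-- over 0 ≤ k ≤ t; binomials C(t,2k), C(t,2k+1) vanish beyond that.
rhsCoeff : ℕ → ℕ → Mono → ℚ
rhsCoeff r t μ =
  sumTo (length μ) (λ n → sumTo t (λ k →
      ℕ→ℚ (t C (2 ℕ.* k)) * ℕ→ℚ (n !) * stirling r n * ℕ→ℚ ((2 ℕ.* k) !)
        * inv (k !) * (((- 1ℚ) ^q k) * inv (24 ℕ.^ k))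
        * coeff (mode (ℤ.- (+ suc n)) (a-1^ (t ∸ 2 ℕ.* k) vac)) μ))
  - sumTo t (λ k →
      ℕ→ℚ (t C suc (2 ℕ.* k)) * bernoulli (suc r) * ℕ→ℚ (suc (2 ℕ.* k) !)
        * inv (k !) * inv (suc r) * (((- 1ℚ) ^q k) * inv (24 ℕ.^ k))
        * coeff (a-1^ (t ∸ suc (2 ℕ.* k)) vac) μ)

module Submission where

-- On a vector built from a(-1) alone, a(0) = 0 and a(m) vanishes for m ≥ 2, so a[-r] acts as
-- Σ_{n<r} c_n a(-n-1) + c a(1) with residue coefficients.  Writing e^z - 1 = z f, the coefficient c_n is
-- the z^{r-1-n} coefficient of e^z f^n, and expanding e^z (e^z - 1)^n into powers e^{jz} turns it into an
-- n-th finite difference of x^{r-1}, i.e. n! S_r^{(n+1)}/(r-1)!.  The coefficient c is the z^{r+1}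
-- coefficient of e^z g² with g = z/(e^z - 1) = Σ B_m z^m/m!; since z(fg)′ = 0 and z f′ = e^z - f one gets
-- e^z g² = g - z g′, hence c = -r B_{r+1}/(r+1)!.  For r = 1 this says a[-1] = a(-1) - a(1)/12 on such
-- vectors, so a[-1]^t 1 expands over the matchings of t points with weight -1/12 per pair.  Applying a[-r]
-- to that expansion yields the two sums of the proposition.

open import Defs

-- Rational arithmetic is opened only inside this block, so that the final statement can use ℕ's _+_ and _*_.
module _ where

  open import Data.Nat as ℕ using (ℕ; zero; suc; _∸_; _≤_; _<_; z≤n; s≤s; _!; NonZero)
  import Data.Nat.Properties as ℕP
  open import Data.Nat.Combinatorics using (_C_; nCk+nC[k+1]≡[n+1]C[k+1]; k![n∸k]!∣n!; nC1≡n)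
  open import Data.Nat.Combinatorics.Specification using (nCk≡n!/k![n-k]!; k>n⇒nCk≡0)
  import Data.Nat.DivMod as ℕDivMod
  import Data.Nat.Coprimality as Coprime
  open import Data.Integer as ℤ using (ℤ; -[1+_]; _⊖_)
  import Data.Integer.Properties as ℤP
  open import Data.Rational as ℚ using (ℚ; mkℚ; 0ℚ; 1ℚ; _+_; _*_; -_; _-_)
  import Data.Rational.Properties as ℚP
  open import Data.Rational.Solver using (module +-*-Solver)
  open +-*-Solver
  open import Data.Bool using (Bool; true; false; _∧_; not; if_then_else_)
  import Data.Bool.Properties as BoolP
  open import Data.List using (List; []; _∷_; _++_; length)
  open import Data.Product using (_,_)
  open import Data.Sum using (inj₁; inj₂)
  open import Relation.Binary.PropositionalEquality
  open import Relation.Nullary using (yes; no)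
  open ≡-Reasoning

  ℕ→ℚ≡mkℚ : ∀ n → ℕ→ℚ n ≡ mkℚ (ℤ.+ n) 0 (Coprime.sym (Coprime.1-coprimeTo n))
  ℕ→ℚ≡mkℚ n = ℚP.normalize-coprime (Coprime.sym (Coprime.1-coprimeTo n))

  ℕ→ℚ-+ : ∀ m n → ℕ→ℚ (m ℕ.+ n) ≡ ℕ→ℚ m + ℕ→ℚ n
  ℕ→ℚ-+ m n rewrite ℕ→ℚ≡mkℚ m | ℕ→ℚ≡mkℚ n =
    ℚP./-cong {q₁ = 1} {q₂ = 1} (sym (cong₂ ℤ._+_ (ℤP.*-identityʳ (ℤ.+ m)) (ℤP.*-identityʳ (ℤ.+ n)))) refl

  ℕ→ℚ-* : ∀ m n → ℕ→ℚ (m ℕ.* n) ≡ ℕ→ℚ m * ℕ→ℚ n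
  ℕ→ℚ-* m n rewrite ℕ→ℚ≡mkℚ m | ℕ→ℚ≡mkℚ n = ℚP./-cong {q₁ = 1} {q₂ = 1} (ℤP.pos-* m n) refl

  inv≡mkℚ : ∀ n → inv (suc n) ≡ mkℚ (ℤ.+ 1) n (Coprime.1-coprimeTo (suc n))
  inv≡mkℚ n = ℚP.normalize-coprime (Coprime.1-coprimeTo (suc n))

  ℕ→ℚ*inv≡1 : ∀ m .{{_ : NonZero m}} → ℕ→ℚ m * inv m ≡ 1ℚ
  ℕ→ℚ*inv≡1 (suc n) rewrite inv≡mkℚ n | ℕ→ℚ≡mkℚ (suc n) =
    ℚP.*-inverseʳ (mkℚ (ℤ.+ suc n) 0 (Coprime.sym (Coprime.1-coprimeTo (suc n))))

  ℕ→ℚ*[inv*x]≡x : ∀ m .{{_ : NonZero m}} x → ℕ→ℚ m * (inv m * x) ≡ x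
  ℕ→ℚ*[inv*x]≡x m x = begin
    ℕ→ℚ m * (inv m * x) ≡⟨ ℚP.*-assoc (ℕ→ℚ m) (inv m) x ⟨
    ℕ→ℚ m * inv m * x   ≡⟨ cong (_* x) (ℕ→ℚ*inv≡1 m) ⟩
    1ℚ * x              ≡⟨ ℚP.*-identityˡ x ⟩
    x                   ∎

  inv-unique : ∀ m x .{{_ : NonZero m}} → ℕ→ℚ m * x ≡ 1ℚ → x ≡ inv m
  inv-unique m x mx≡1 = begin
    x                       ≡⟨ ℕ→ℚ*[inv*x]≡x m x ⟨
    ℕ→ℚ m * (inv m * x)     ≡⟨ solve 3 (λ a b x → a :* (b :* x) := (a :* x) :* b) refl (ℕ→ℚ m) (inv m) x ⟩
    ℕ→ℚ m * x * inv m       ≡⟨ cong (_* inv m) mx≡1 ⟩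
    1ℚ * inv m              ≡⟨ ℚP.*-identityˡ (inv m) ⟩
    inv m                   ∎

  inv-* : ∀ a b .{{_ : NonZero a}} .{{_ : NonZero b}} → inv (a ℕ.* b) ≡ inv a * inv b
  inv-* a b = sym (inv-unique (a ℕ.* b) (inv a * inv b) {{ℕP.m*n≢0 a b}} (begin
    ℕ→ℚ (a ℕ.* b) * (inv a * inv b)       ≡⟨ cong (_* (inv a * inv b)) (ℕ→ℚ-* a b) ⟩
    ℕ→ℚ a * ℕ→ℚ b * (inv a * inv b)       ≡⟨ solve 4 (λ a b x y → a :* b :* (x :* y) := (a :* x) :* (b :* y)) refl
                                                    (ℕ→ℚ a) (ℕ→ℚ b) (inv a) (inv b) ⟩
    ℕ→ℚ a * inv a * (ℕ→ℚ b * inv b)       ≡⟨ cong₂ _*_ (ℕ→ℚ*inv≡1 a) (ℕ→ℚ*inv≡1 b) ⟩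
    1ℚ * 1ℚ                               ≡⟨⟩
    1ℚ                                    ∎))

  -- Finite sums

  sumTo-cong≤ : ∀ n {f g : ℕ → ℚ} → (∀ i → i ≤ n → f i ≡ g i) → sumTo n f ≡ sumTo n g
  sumTo-cong≤ zero    f≡g = f≡g 0 z≤n
  sumTo-cong≤ (suc n) f≡g =
    cong₂ _+_ (sumTo-cong≤ n (λ i i≤n → f≡g i (ℕP.m≤n⇒m≤1+n i≤n))) (f≡g (suc n) ℕP.≤-refl)

  sumTo-cong : ∀ n {f g : ℕ → ℚ} → (∀ i → f i ≡ g i) → sumTo n f ≡ sumTo n g
  sumTo-cong n f≡g = sumTo-cong≤ n (λ i _ → f≡g i)

  sumTo-zero : ∀ n (f : ℕ → ℚ) → (∀ i → i ≤ n → f i ≡ 0ℚ) → sumTo n f ≡ 0ℚ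
  sumTo-zero zero    f f≡0 = f≡0 0 z≤n
  sumTo-zero (suc n) f f≡0 =
    cong₂ _+_ (sumTo-zero n f (λ i i≤n → f≡0 i (ℕP.m≤n⇒m≤1+n i≤n))) (f≡0 (suc n) ℕP.≤-refl)

  sumTo-+ : ∀ n (f g : ℕ → ℚ) → sumTo n (λ i → f i + g i) ≡ sumTo n f + sumTo n g
  sumTo-+ zero    f g = refl
  sumTo-+ (suc n) f g = begin
    sumTo n (λ i → f i + g i) + (f (suc n) + g (suc n))
      ≡⟨ cong (_+ (f (suc n) + g (suc n))) (sumTo-+ n f g) ⟩
    (sumTo n f + sumTo n g) + (f (suc n) + g (suc n))
      ≡⟨ solve 4 (λ a b c d → (a :+ b) :+ (c :+ d) := (a :+ c) :+ (b :+ d)) refl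
           (sumTo n f) (sumTo n g) (f (suc n)) (g (suc n)) ⟩
    (sumTo n f + f (suc n)) + (sumTo n g + g (suc n)) ∎

  sumTo-*ˡ : ∀ n q (f : ℕ → ℚ) → q * sumTo n f ≡ sumTo n (λ i → q * f i)
  sumTo-*ˡ zero    q f = refl
  sumTo-*ˡ (suc n) q f =
    trans (ℚP.*-distribˡ-+ q (sumTo n f) (f (suc n))) (cong (_+ (q * f (suc n))) (sumTo-*ˡ n q f))

  sumTo-*ʳ : ∀ n q (f : ℕ → ℚ) → sumTo n f * q ≡ sumTo n (λ i → f i * q)
  sumTo-*ʳ n q f =
    trans (ℚP.*-comm (sumTo n f) q) (trans (sumTo-*ˡ n q f) (sumTo-cong n (λ i → ℚP.*-comm q (f i))))

  sumTo-neg : ∀ n (f : ℕ → ℚ) → - sumTo n f ≡ sumTo n (λ i → - f i)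
  sumTo-neg zero    f = refl
  sumTo-neg (suc n) f =
    trans (ℚP.neg-distrib-+ (sumTo n f) (f (suc n))) (cong (_+ (- f (suc n))) (sumTo-neg n f))

  sumTo-suc : ∀ n (f : ℕ → ℚ) → sumTo (suc n) f ≡ f 0 + sumTo n (λ i → f (suc i))
  sumTo-suc zero    f = refl
  sumTo-suc (suc n) f = begin
    sumTo (suc n) f + f (suc (suc n))
      ≡⟨ cong (_+ f (suc (suc n))) (sumTo-suc n f) ⟩
    (f 0 + sumTo n (λ i → f (suc i))) + f (suc (suc n))
      ≡⟨ ℚP.+-assoc (f 0) _ _ ⟩
    f 0 + (sumTo n (λ i → f (suc i)) + f (suc (suc n))) ∎

  sumTo-reverse : ∀ n (f : ℕ → ℚ) → sumTo n f ≡ sumTo n (λ i → f (n ∸ i))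
  sumTo-reverse zero    f = refl
  sumTo-reverse (suc n) f = begin
    sumTo n f + f (suc n)
      ≡⟨ cong (_+ f (suc n)) (sumTo-reverse n f) ⟩
    sumTo n (λ i → f (n ∸ i)) + f (suc n)
      ≡⟨ ℚP.+-comm (sumTo n (λ i → f (n ∸ i))) (f (suc n)) ⟩
    f (suc n) + sumTo n (λ i → f (n ∸ i))
      ≡⟨ sumTo-suc n (λ i → f (suc n ∸ i)) ⟨
    sumTo (suc n) (λ i → f (suc n ∸ i)) ∎

  sumTo-vanishing-tail : ∀ m n (f : ℕ → ℚ) → m ≤ n → (∀ i → m < i → f i ≡ 0ℚ) → sumTo n f ≡ sumTo m f
  sumTo-vanishing-tail m zero    f z≤n  f≡0 = refl
  sumTo-vanishing-tail m (suc n) f m≤1+n f≡0 with ℕP.m≤n⇒m<n∨m≡n m≤1+n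
  ... | inj₂ refl          = refl
  ... | inj₁ (s≤s m≤n) = begin
    sumTo n f + f (suc n) ≡⟨ cong₂ _+_ (sumTo-vanishing-tail m n f m≤n f≡0) (f≡0 (suc n) (s≤s m≤n)) ⟩
    sumTo m f + 0ℚ        ≡⟨ ℚP.+-identityʳ _ ⟩
    sumTo m f             ∎

  sumTo-vanishing-tails : ∀ m n (f : ℕ → ℚ) → (∀ i → m < i → f i ≡ 0ℚ) → (∀ i → n < i → f i ≡ 0ℚ) →
    sumTo m f ≡ sumTo n f
  sumTo-vanishing-tails m n f f≡0>m f≡0>n with ℕP.≤-total m n
  ... | inj₁ m≤n = sym (sumTo-vanishing-tail m n f m≤n f≡0>m)
  ... | inj₂ n≤m = sumTo-vanishing-tail n m f n≤m f≡0>n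

  sumTo-triangle : ∀ k (F : ℕ → ℕ → ℚ) →
    sumTo k (λ j → sumTo (k ∸ j) (F j)) ≡ sumTo k (λ l → sumTo l (λ j → F j (l ∸ j)))
  sumTo-triangle zero    F = refl
  sumTo-triangle (suc k) F = begin
    sumTo k (λ j → sumTo (suc k ∸ j) (F j)) + sumTo (k ∸ k) (F (suc k))
      ≡⟨ cong₂ _+_ (sumTo-cong≤ k (λ j j≤k → cong (λ x → sumTo x (F j)) (ℕP.+-∸-assoc 1 j≤k)))
                   (cong (λ x → sumTo x (F (suc k))) (ℕP.n∸n≡0 k)) ⟩
    sumTo k (λ j → sumTo (k ∸ j) (F j) + F j (suc (k ∸ j))) + F (suc k) 0
      ≡⟨ cong (_+ F (suc k) 0) (sumTo-+ k _ _) ⟩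
    (sumTo k (λ j → sumTo (k ∸ j) (F j)) + sumTo k (λ j → F j (suc (k ∸ j)))) + F (suc k) 0
      ≡⟨ ℚP.+-assoc (sumTo k (λ j → sumTo (k ∸ j) (F j))) _ _ ⟩
    sumTo k (λ j → sumTo (k ∸ j) (F j)) + (sumTo k (λ j → F j (suc (k ∸ j))) + F (suc k) 0)
      ≡⟨ cong₂ _+_ (sumTo-triangle k F)
           (cong₂ _+_ (sumTo-cong≤ k (λ j j≤k → cong (F j) (sym (ℕP.+-∸-assoc 1 j≤k))))
                      (cong (F (suc k)) (sym (ℕP.n∸n≡0 k)))) ⟩
    sumTo k (λ l → sumTo l (λ j → F j (l ∸ j))) + sumTo (suc k) (λ j → F j (suc k ∸ j)) ∎

  -- Formal power series

  infix 4 _≈ₚ_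
  _≈ₚ_ : PS → PS → Set
  p ≈ₚ q = ∀ k → p k ≡ q k

  psOne : PS
  psOne zero    = 1ℚ
  psOne (suc _) = 0ℚ

  psPow-zero : ∀ p → psPow p 0 ≈ₚ psOne
  psPow-zero p zero    = refl
  psPow-zero p (suc k) = refl

  psMul-cong : ∀ {p p′ q q′} → p ≈ₚ p′ → q ≈ₚ q′ → psMul p q ≈ₚ psMul p′ q′
  psMul-cong p≈p′ q≈q′ k = sumTo-cong k (λ j → cong₂ _*_ (p≈p′ j) (q≈q′ (k ∸ j)))

  psMul-congʳ : ∀ {p p′} q → p ≈ₚ p′ → psMul p q ≈ₚ psMul p′ q
  psMul-congʳ q p≈p′ = psMul-cong {q = q} p≈p′ (λ _ → refl)

  psMul-congˡ : ∀ p {q q′} → q ≈ₚ q′ → psMul p q ≈ₚ psMul p q′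
  psMul-congˡ p q≈q′ = psMul-cong {p = p} (λ _ → refl) q≈q′

  psMul-comm : ∀ p q → psMul p q ≈ₚ psMul q p
  psMul-comm p q k = begin
    sumTo k (λ j → p j * q (k ∸ j))
      ≡⟨ sumTo-reverse k _ ⟩
    sumTo k (λ j → p (k ∸ j) * q (k ∸ (k ∸ j)))
      ≡⟨ sumTo-cong≤ k (λ j j≤k → trans (cong (λ x → p (k ∸ j) * q x) (ℕP.m∸[m∸n]≡n j≤k))
                                         (ℚP.*-comm (p (k ∸ j)) (q j))) ⟩
    sumTo k (λ j → q j * p (k ∸ j)) ∎

  psMul-assoc : ∀ p q s → psMul p (psMul q s) ≈ₚ psMul (psMul p q) s
  psMul-assoc p q s k = begin
    sumTo k (λ j → p j * sumTo (k ∸ j) (λ i → q i * s (k ∸ j ∸ i)))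
      ≡⟨ sumTo-cong k (λ j → sumTo-*ˡ (k ∸ j) (p j) _) ⟩
    sumTo k (λ j → sumTo (k ∸ j) (λ i → p j * (q i * s (k ∸ j ∸ i))))
      ≡⟨ sumTo-triangle k (λ j i → p j * (q i * s (k ∸ j ∸ i))) ⟩
    sumTo k (λ l → sumTo l (λ j → p j * (q (l ∸ j) * s (k ∸ j ∸ (l ∸ j)))))
      ≡⟨ sumTo-cong≤ k (λ l _ → sumTo-cong≤ l (λ j j≤l →
           trans (cong (λ x → p j * (q (l ∸ j) * s x)) (∸-∸-cancel j≤l))
                 (sym (ℚP.*-assoc (p j) (q (l ∸ j)) (s (k ∸ l)))))) ⟩
    sumTo k (λ l → sumTo l (λ j → p j * q (l ∸ j) * s (k ∸ l)))
      ≡⟨ sumTo-cong k (λ l → sym (sumTo-*ʳ l (s (k ∸ l)) _)) ⟩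
    sumTo k (λ l → sumTo l (λ j → p j * q (l ∸ j)) * s (k ∸ l)) ∎
    where
    ∸-∸-cancel : ∀ {j l} → j ≤ l → (k ∸ j) ∸ (l ∸ j) ≡ k ∸ l
    ∸-∸-cancel {j} {l} j≤l = trans (ℕP.∸-+-assoc k j (l ∸ j)) (cong (k ∸_) (ℕP.m+[n∸m]≡n j≤l))

  psMul-lcomm : ∀ p q s → psMul p (psMul q s) ≈ₚ psMul q (psMul p s)
  psMul-lcomm p q s k = begin
    psMul p (psMul q s) k ≡⟨ psMul-assoc p q s k ⟩
    psMul (psMul p q) s k ≡⟨ psMul-congʳ s (psMul-comm p q) k ⟩
    psMul (psMul q p) s k ≡⟨ psMul-assoc q p s k ⟨
    psMul q (psMul p s) k ∎

  psMul-identityʳ : ∀ p → psMul p psOne ≈ₚ p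
  psMul-identityʳ p zero    = ℚP.*-identityʳ (p 0)
  psMul-identityʳ p (suc k) = begin
    sumTo k (λ j → p j * psOne (suc k ∸ j)) + p (suc k) * psOne (k ∸ k)
      ≡⟨ cong₂ _+_ (sumTo-zero k _ (λ j j≤k → trans (cong (λ x → p j * psOne x) (ℕP.+-∸-assoc 1 j≤k))
                                                    (ℚP.*-zeroʳ (p j))))
                   (trans (cong (λ x → p (suc k) * psOne x) (ℕP.n∸n≡0 k)) (ℚP.*-identityʳ (p (suc k)))) ⟩
    0ℚ + p (suc k)
      ≡⟨ ℚP.+-identityˡ _ ⟩
    p (suc k) ∎

  psMul-identityˡ : ∀ p → psMul psOne p ≈ₚ p
  psMul-identityˡ p k = trans (psMul-comm psOne p k) (psMul-identityʳ p k)

  psMul-pow-zeroʳ : ∀ p q → psMul q (psPow p 0) ≈ₚ q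
  psMul-pow-zeroʳ p q k = trans (psMul-congˡ q (psPow-zero p) k) (psMul-identityʳ q k)

  psMul-distribˡ-+ : ∀ p q s → psMul p (λ i → q i + s i) ≈ₚ (λ k → psMul p q k + psMul p s k)
  psMul-distribˡ-+ p q s k =
    trans (sumTo-cong k (λ j → ℚP.*-distribˡ-+ (p j) (q (k ∸ j)) (s (k ∸ j)))) (sumTo-+ k _ _)

  psMul-negʳ : ∀ p q → psMul p (λ i → - q i) ≈ₚ (λ k → - psMul p q k)
  psMul-negʳ p q k =
    trans (sumTo-cong k (λ j → sym (ℚP.neg-distribʳ-* (p j) (q (k ∸ j))))) (sym (sumTo-neg k _))

  psMul-distribˡ-- : ∀ p q s → psMul p (λ i → q i - s i) ≈ₚ (λ k → psMul p q k - psMul p s k)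
  psMul-distribˡ-- p q s k =
    trans (psMul-distribˡ-+ p q (λ i → - s i) k) (cong (λ x → psMul p q k + x) (psMul-negʳ p s k))

  psMul-distribʳ-- : ∀ p q s → psMul (λ i → q i - s i) p ≈ₚ (λ k → psMul q p k - psMul s p k)
  psMul-distribʳ-- p q s k = begin
    psMul (λ i → q i - s i) p k         ≡⟨ psMul-comm (λ i → q i - s i) p k ⟩
    psMul p (λ i → q i - s i) k         ≡⟨ psMul-distribˡ-- p q s k ⟩
    psMul p q k - psMul p s k           ≡⟨ cong₂ _-_ (psMul-comm p q k) (psMul-comm p s k) ⟩
    psMul q p k - psMul s p k           ∎

  z* : PS → PS
  z* A zero    = 0ℚ
  z* A (suc k) = A k

  psMul-z*-zero : ∀ A X → psMul A (z* X) 0 ≡ 0ℚ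
  psMul-z*-zero A X = ℚP.*-zeroʳ (A 0)

  psMul-z*-suc : ∀ A X k → psMul A (z* X) (suc k) ≡ psMul A X k
  psMul-z*-suc A X k = begin
    sumTo k (λ j → A j * z* X (suc k ∸ j)) + A (suc k) * z* X (k ∸ k)
      ≡⟨ cong₂ _+_ (sumTo-cong≤ k (λ j j≤k → cong (λ x → A j * z* X x) (ℕP.+-∸-assoc 1 j≤k)))
                   (trans (cong (λ x → A (suc k) * z* X x) (ℕP.n∸n≡0 k)) (ℚP.*-zeroʳ (A (suc k)))) ⟩
    psMul A X k + 0ℚ ≡⟨ ℚP.+-identityʳ _ ⟩
    psMul A X k ∎

  -- Binomial coefficients and finite differences

  inv[j!]*inv[[d∸j]!]≡dCj*inv[d!] : ∀ {d j} → j ≤ d → inv (j !) * inv ((d ∸ j) !) ≡ ℕ→ℚ (d C j) * inv (d !)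
  inv[j!]*inv[[d∸j]!]≡dCj*inv[d!] {d} {j} j≤d = begin
    inv (j !) * inv ((d ∸ j) !) ≡⟨ inv-* (j !) ((d ∸ j) !) {{j ℕP.!≢0}} {{(d ∸ j) ℕP.!≢0}} ⟨
    inv (j! ℕ.* [d∸j]!)         ≡⟨ inv-unique (j! ℕ.* [d∸j]!) (ℕ→ℚ (d C j) * inv (d !)) {{j ℕP.!* (d ∸ j) !≢0}} inverse ⟨
    ℕ→ℚ (d C j) * inv (d !)     ∎
    where
    j! = j !
    [d∸j]! = (d ∸ j) !
    dCj*j!*[d∸j]!≡d! : (d C j) ℕ.* (j! ℕ.* [d∸j]!) ≡ d !
    dCj*j!*[d∸j]!≡d! = trans (cong (ℕ._* (j! ℕ.* [d∸j]!)) (nCk≡n!/k![n-k]! j≤d))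
                             (ℕDivMod.m/n*n≡m {{j ℕP.!* (d ∸ j) !≢0}} (k![n∸k]!∣n! j≤d))
    inverse : ℕ→ℚ (j! ℕ.* [d∸j]!) * (ℕ→ℚ (d C j) * inv (d !)) ≡ 1ℚ
    inverse = begin
      ℕ→ℚ (j! ℕ.* [d∸j]!) * (ℕ→ℚ (d C j) * inv (d !))
        ≡⟨ solve 3 (λ a c i → a :* (c :* i) := c :* a :* i) refl (ℕ→ℚ (j! ℕ.* [d∸j]!)) (ℕ→ℚ (d C j)) (inv (d !)) ⟩
      ℕ→ℚ (d C j) * ℕ→ℚ (j! ℕ.* [d∸j]!) * inv (d !)
        ≡⟨ cong (_* inv (d !)) (trans (sym (ℕ→ℚ-* (d C j) _)) (cong ℕ→ℚ dCj*j!*[d∸j]!≡d!)) ⟩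
      ℕ→ℚ (d !) * inv (d !)
        ≡⟨ ℕ→ℚ*inv≡1 (d !) {{d ℕP.!≢0}} ⟩
      1ℚ ∎

  nCk*[n∸k]≡nC[1+k]*[1+k] : ∀ n k → (n C k) ℕ.* (n ∸ k) ≡ (n C suc k) ℕ.* suc k
  nCk*[n∸k]≡nC[1+k]*[1+k] zero k =
    trans (trans (cong ((0 C k) ℕ.*_) (ℕP.0∸n≡0 k)) (ℕP.*-zeroʳ (0 C k)))
          (sym (cong (ℕ._* suc k) (k>n⇒nCk≡0 {0} {suc k} (s≤s z≤n))))
  nCk*[n∸k]≡nC[1+k]*[1+k] (suc n) zero rewrite nC1≡n (suc n) = trans (ℕP.+-identityʳ (suc n)) (sym (ℕP.*-identityʳ (suc n)))
  nCk*[n∸k]≡nC[1+k]*[1+k] (suc n) (suc k) = begin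
    (suc n C suc k) ℕ.* (n ∸ k)
      ≡⟨ cong (ℕ._* (n ∸ k)) (nCk+nC[k+1]≡[n+1]C[k+1] n k) ⟨
    (n C k ℕ.+ n C suc k) ℕ.* (n ∸ k)
      ≡⟨ ℕP.*-distribʳ-+ (n ∸ k) (n C k) (n C suc k) ⟩
    (n C k) ℕ.* (n ∸ k) ℕ.+ (n C suc k) ℕ.* (n ∸ k)
      ≡⟨ cong (ℕ._+ (n C suc k) ℕ.* (n ∸ k)) (nCk*[n∸k]≡nC[1+k]*[1+k] n k) ⟩
    (n C suc k) ℕ.* suc k ℕ.+ (n C suc k) ℕ.* (n ∸ k)
      ≡⟨ ℕP.*-distribˡ-+ (n C suc k) (suc k) (n ∸ k) ⟨
    (n C suc k) ℕ.* (suc k ℕ.+ (n ∸ k))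
      ≡⟨ nCk*[1+k+[n∸k]]≡nCk*[2+k+[n∸1+k]] ⟩
    (n C suc k) ℕ.* (suc (suc k) ℕ.+ (n ∸ suc k))
      ≡⟨ ℕP.*-distribˡ-+ (n C suc k) (suc (suc k)) (n ∸ suc k) ⟩
    (n C suc k) ℕ.* suc (suc k) ℕ.+ (n C suc k) ℕ.* (n ∸ suc k)
      ≡⟨ cong ((n C suc k) ℕ.* suc (suc k) ℕ.+_) (nCk*[n∸k]≡nC[1+k]*[1+k] n (suc k)) ⟩
    (n C suc k) ℕ.* suc (suc k) ℕ.+ (n C suc (suc k)) ℕ.* suc (suc k)
      ≡⟨ ℕP.*-distribʳ-+ (suc (suc k)) (n C suc k) (n C suc (suc k)) ⟨
    (n C suc k ℕ.+ n C suc (suc k)) ℕ.* suc (suc k)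
      ≡⟨ cong (ℕ._* suc (suc k)) (nCk+nC[k+1]≡[n+1]C[k+1] n (suc k)) ⟩
    (suc n C suc (suc k)) ℕ.* suc (suc k) ∎
    where
    nCk*[1+k+[n∸k]]≡nCk*[2+k+[n∸1+k]] :
      (n C suc k) ℕ.* (suc k ℕ.+ (n ∸ k)) ≡ (n C suc k) ℕ.* (suc (suc k) ℕ.+ (n ∸ suc k))
    nCk*[1+k+[n∸k]]≡nCk*[2+k+[n∸1+k]] with suc k ℕ.≤? n
    ... | yes k<n = cong (λ x → (n C suc k) ℕ.* suc x)
                         (trans (cong (k ℕ.+_) (ℕP.+-∸-assoc 1 k<n)) (ℕP.+-suc k (n ∸ suc k)))
    ... | no k≮n rewrite k>n⇒nCk≡0 (ℕP.≰⇒> k≮n) = refl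

  sumTo-binomial-pascal : ∀ n (g : ℕ → ℚ) →
    sumTo (suc n) (λ j → ℕ→ℚ (suc n C j) * g j)
      ≡ sumTo n (λ j → ℕ→ℚ (n C j) * g j) + sumTo n (λ j → ℕ→ℚ (n C j) * g (suc j))
  sumTo-binomial-pascal n g = begin
    sumTo (suc n) (λ j → ℕ→ℚ (suc n C j) * g j)
      ≡⟨ sumTo-suc n _ ⟩
    ℕ→ℚ 1 * g 0 + sumTo n (λ j → ℕ→ℚ (suc n C suc j) * g (suc j))
      ≡⟨ cong (ℕ→ℚ 1 * g 0 +_) (sumTo-cong n pascal-term) ⟩
    ℕ→ℚ 1 * g 0 + sumTo n (λ j → ℕ→ℚ (n C j) * g (suc j) + ℕ→ℚ (n C suc j) * g (suc j))
      ≡⟨ cong (ℕ→ℚ 1 * g 0 +_) (sumTo-+ n _ _) ⟩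
    ℕ→ℚ 1 * g 0 + (X + Y)
      ≡⟨ solve 3 (λ a x y → a :+ (x :+ y) := (a :+ y) :+ x) refl (ℕ→ℚ 1 * g 0) X Y ⟩
    (ℕ→ℚ 1 * g 0 + Y) + X
      ≡⟨ cong (_+ X) (sumTo-suc n (λ j → ℕ→ℚ (n C j) * g j)) ⟨
    sumTo n (λ j → ℕ→ℚ (n C j) * g j) + ℕ→ℚ (n C suc n) * g (suc n) + X
      ≡⟨ cong (λ z → sumTo n (λ j → ℕ→ℚ (n C j) * g j) + ℕ→ℚ z * g (suc n) + X) (k>n⇒nCk≡0 (ℕP.n<1+n n)) ⟩
    sumTo n (λ j → ℕ→ℚ (n C j) * g j) + 0ℚ * g (suc n) + X
      ≡⟨ cong (λ z → z + X) (trans (cong (sumTo n (λ j → ℕ→ℚ (n C j) * g j) +_) (ℚP.*-zeroˡ (g (suc n))))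
                                   (ℚP.+-identityʳ (sumTo n (λ j → ℕ→ℚ (n C j) * g j)))) ⟩
    sumTo n (λ j → ℕ→ℚ (n C j) * g j) + X ∎
    where
    X = sumTo n (λ j → ℕ→ℚ (n C j) * g (suc j))
    Y = sumTo n (λ j → ℕ→ℚ (n C suc j) * g (suc j))
    pascal-term : ∀ j → ℕ→ℚ (suc n C suc j) * g (suc j) ≡ ℕ→ℚ (n C j) * g (suc j) + ℕ→ℚ (n C suc j) * g (suc j)
    pascal-term j = begin
      ℕ→ℚ (suc n C suc j) * g (suc j)              ≡⟨ cong (λ x → ℕ→ℚ x * g (suc j)) (nCk+nC[k+1]≡[n+1]C[k+1] n j) ⟨
      ℕ→ℚ (n C j ℕ.+ n C suc j) * g (suc j)        ≡⟨ cong (_* g (suc j)) (ℕ→ℚ-+ (n C j) (n C suc j)) ⟩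
      (ℕ→ℚ (n C j) + ℕ→ℚ (n C suc j)) * g (suc j)  ≡⟨ ℚP.*-distribʳ-+ (g (suc j)) (ℕ→ℚ (n C j)) (ℕ→ℚ (n C suc j)) ⟩
      ℕ→ℚ (n C j) * g (suc j) + ℕ→ℚ (n C suc j) * g (suc j) ∎

  binomial-theorem : ∀ c d → sumTo d (λ j → ℕ→ℚ (d C j) * ℕ→ℚ (c ℕ.^ (d ∸ j))) ≡ ℕ→ℚ (suc c ℕ.^ d)
  binomial-theorem c zero    = refl
  binomial-theorem c (suc d) = begin
    sumTo (suc d) (λ j → ℕ→ℚ (suc d C j) * ℕ→ℚ (c ℕ.^ (suc d ∸ j)))
      ≡⟨ sumTo-binomial-pascal d (λ j → ℕ→ℚ (c ℕ.^ (suc d ∸ j))) ⟩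
    sumTo d (λ j → ℕ→ℚ (d C j) * ℕ→ℚ (c ℕ.^ (suc d ∸ j))) + S
      ≡⟨ cong (_+ S) (sumTo-cong≤ d c-term) ⟩
    sumTo d (λ j → ℕ→ℚ c * (ℕ→ℚ (d C j) * ℕ→ℚ (c ℕ.^ (d ∸ j)))) + S
      ≡⟨ cong (_+ S) (sumTo-*ˡ d (ℕ→ℚ c) _) ⟨
    ℕ→ℚ c * S + S
      ≡⟨ cong (λ x → ℕ→ℚ c * x + x) (binomial-theorem c d) ⟩
    ℕ→ℚ c * ℕ→ℚ [1+c]^d + ℕ→ℚ [1+c]^d
      ≡⟨ ℚP.+-comm (ℕ→ℚ c * ℕ→ℚ [1+c]^d) (ℕ→ℚ [1+c]^d) ⟩
    ℕ→ℚ [1+c]^d + ℕ→ℚ c * ℕ→ℚ [1+c]^d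
      ≡⟨ trans (ℕ→ℚ-+ [1+c]^d (c ℕ.* [1+c]^d)) (cong (ℕ→ℚ [1+c]^d +_) (ℕ→ℚ-* c [1+c]^d)) ⟨
    ℕ→ℚ (suc c ℕ.^ suc d) ∎
    where
    S = sumTo d (λ j → ℕ→ℚ (d C j) * ℕ→ℚ (c ℕ.^ (d ∸ j)))
    [1+c]^d = suc c ℕ.^ d
    c-term : ∀ j → j ≤ d → ℕ→ℚ (d C j) * ℕ→ℚ (c ℕ.^ (suc d ∸ j)) ≡ ℕ→ℚ c * (ℕ→ℚ (d C j) * ℕ→ℚ (c ℕ.^ (d ∸ j)))
    c-term j j≤d rewrite ℕP.+-∸-assoc 1 j≤d | ℕ→ℚ-* c (c ℕ.^ (d ∸ j)) =
      solve 3 (λ a b x → a :* (x :* b) := x :* (a :* b)) refl (ℕ→ℚ (d C j)) (ℕ→ℚ (c ℕ.^ (d ∸ j))) (ℕ→ℚ c)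

  expPow : ℕ → PS
  expPow c = psPow expPS c

  expPow-coeff : ∀ c d → expPow c d ≡ ℕ→ℚ (c ℕ.^ d) * inv (d !)
  expPow-coeff zero    zero    = refl
  expPow-coeff zero    (suc d) = sym (ℚP.*-zeroˡ (inv (suc d !)))
  expPow-coeff (suc c) d = begin
    sumTo d (λ j → inv (j !) * expPow c (d ∸ j))
      ≡⟨ sumTo-cong≤ d term ⟩
    sumTo d (λ j → ℕ→ℚ (d C j) * ℕ→ℚ (c ℕ.^ (d ∸ j)) * inv (d !))
      ≡⟨ sumTo-*ʳ d (inv (d !)) _ ⟨
    sumTo d (λ j → ℕ→ℚ (d C j) * ℕ→ℚ (c ℕ.^ (d ∸ j))) * inv (d !)
      ≡⟨ cong (_* inv (d !)) (binomial-theorem c d) ⟩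
    ℕ→ℚ (suc c ℕ.^ d) * inv (d !) ∎
    where
    term : ∀ j → j ≤ d → inv (j !) * expPow c (d ∸ j) ≡ ℕ→ℚ (d C j) * ℕ→ℚ (c ℕ.^ (d ∸ j)) * inv (d !)
    term j j≤d = begin
      inv (j !) * expPow c (d ∸ j)
        ≡⟨ cong (inv (j !) *_) (expPow-coeff c (d ∸ j)) ⟩
      inv (j !) * (ℕ→ℚ (c ℕ.^ (d ∸ j)) * inv ((d ∸ j) !))
        ≡⟨ solve 3 (λ a x y → a :* (x :* y) := x :* (a :* y)) refl (inv (j !)) (ℕ→ℚ (c ℕ.^ (d ∸ j))) (inv ((d ∸ j) !)) ⟩
      ℕ→ℚ (c ℕ.^ (d ∸ j)) * (inv (j !) * inv ((d ∸ j) !))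
        ≡⟨ cong (ℕ→ℚ (c ℕ.^ (d ∸ j)) *_) (inv[j!]*inv[[d∸j]!]≡dCj*inv[d!] j≤d) ⟩
      ℕ→ℚ (c ℕ.^ (d ∸ j)) * (ℕ→ℚ (d C j) * inv (d !))
        ≡⟨ solve 3 (λ x a b → x :* (a :* b) := a :* x :* b) refl (ℕ→ℚ (c ℕ.^ (d ∸ j))) (ℕ→ℚ (d C j)) (inv (d !)) ⟩
      ℕ→ℚ (d C j) * ℕ→ℚ (c ℕ.^ (d ∸ j)) * inv (d !) ∎

  expPow-one : expPow 1 ≈ₚ expPS
  expPow-one = psMul-pow-zeroʳ expPS expPS

  expm1 : PS
  expm1 = z* fPS

  expm1≈exp-one : ∀ k → expm1 k ≡ expPS k - psOne k
  expm1≈exp-one zero    = refl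
  expm1≈exp-one (suc k) = sym (ℚP.+-identityʳ (inv (suc k !)))

  finiteDiff : ℕ → ℕ → ℕ → ℚ
  finiteDiff n c N = sumTo n (λ j → ℕ→ℚ (n C j) * ((- 1ℚ) ^q (n ℕ.+ j)) * ℕ→ℚ ((c ℕ.+ j) ℕ.^ N))

  finiteDiff-suc : ∀ n c N → finiteDiff (suc n) c N ≡ finiteDiff n (suc c) N - finiteDiff n c N
  finiteDiff-suc n c N = begin
    finiteDiff (suc n) c N
      ≡⟨ sumTo-cong (suc n) (λ j → ℚP.*-assoc (ℕ→ℚ (suc n C j)) _ _) ⟩
    sumTo (suc n) (λ j → ℕ→ℚ (suc n C j) * g j)
      ≡⟨ sumTo-binomial-pascal n g ⟩
    sumTo n (λ j → ℕ→ℚ (n C j) * g j) + sumTo n (λ j → ℕ→ℚ (n C j) * g (suc j))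
      ≡⟨ cong₂ _+_ (trans (sumTo-cong n sign-flip) (sym (sumTo-neg n _))) (sumTo-cong n shift) ⟩
    - finiteDiff n c N + finiteDiff n (suc c) N
      ≡⟨ ℚP.+-comm (- finiteDiff n c N) (finiteDiff n (suc c) N) ⟩
    finiteDiff n (suc c) N - finiteDiff n c N ∎
    where
    g : ℕ → ℚ
    g j = ((- 1ℚ) ^q (suc n ℕ.+ j)) * ℕ→ℚ ((c ℕ.+ j) ℕ.^ N)
    sign-flip : ∀ j → ℕ→ℚ (n C j) * g j ≡ - (ℕ→ℚ (n C j) * ((- 1ℚ) ^q (n ℕ.+ j)) * ℕ→ℚ ((c ℕ.+ j) ℕ.^ N))
    sign-flip j = solve 3 (λ a s x → a :* ((con (- 1ℚ) :* s) :* x) := :- (a :* s :* x)) refl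
                    (ℕ→ℚ (n C j)) ((- 1ℚ) ^q (n ℕ.+ j)) (ℕ→ℚ ((c ℕ.+ j) ℕ.^ N))
    shift : ∀ j → ℕ→ℚ (n C j) * g (suc j) ≡ ℕ→ℚ (n C j) * ((- 1ℚ) ^q (n ℕ.+ j)) * ℕ→ℚ ((suc c ℕ.+ j) ℕ.^ N)
    shift j rewrite ℕP.+-suc n j | ℕP.+-suc c j =
      solve 3 (λ a s x → a :* ((con (- 1ℚ) :* (con (- 1ℚ) :* s)) :* x) := a :* s :* x) refl
        (ℕ→ℚ (n C j)) ((- 1ℚ) ^q (n ℕ.+ j)) (ℕ→ℚ ((suc c ℕ.+ j) ℕ.^ N))

  expPow*expm1^n-coeff : ∀ n c N → psMul (expPow c) (psPow expm1 n) N ≡ inv (N !) * finiteDiff n c N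
  expPow*expm1^n-coeff zero c N = begin
    psMul (expPow c) (psPow expm1 0) N
      ≡⟨ psMul-pow-zeroʳ expm1 (expPow c) N ⟩
    expPow c N
      ≡⟨ expPow-coeff c N ⟩
    ℕ→ℚ (c ℕ.^ N) * inv (N !)
      ≡⟨ solve 2 (λ x y → x :* y := y :* (con 1ℚ :* con 1ℚ :* x)) refl (ℕ→ℚ (c ℕ.^ N)) (inv (N !)) ⟩
    inv (N !) * (ℕ→ℚ 1 * ((- 1ℚ) ^q 0) * ℕ→ℚ (c ℕ.^ N))
      ≡⟨ cong (λ x → inv (N !) * (ℕ→ℚ 1 * ((- 1ℚ) ^q 0) * ℕ→ℚ (x ℕ.^ N))) (ℕP.+-identityʳ c) ⟨
    inv (N !) * finiteDiff zero c N ∎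
  expPow*expm1^n-coeff (suc n) c N = begin
    psMul (expPow c) (psMul expm1 P) N
      ≡⟨ psMul-lcomm (expPow c) expm1 P N ⟩
    psMul expm1 (psMul (expPow c) P) N
      ≡⟨ psMul-congʳ (psMul (expPow c) P) expm1≈exp-one N ⟩
    psMul (λ i → expPS i - psOne i) (psMul (expPow c) P) N
      ≡⟨ psMul-distribʳ-- (psMul (expPow c) P) expPS psOne N ⟩
    psMul expPS (psMul (expPow c) P) N - psMul psOne (psMul (expPow c) P) N
      ≡⟨ cong₂ _-_ (psMul-assoc expPS (expPow c) P N) (psMul-identityˡ (psMul (expPow c) P) N) ⟩
    psMul (expPow (suc c)) P N - psMul (expPow c) P N
      ≡⟨ cong₂ _-_ (expPow*expm1^n-coeff n (suc c) N) (expPow*expm1^n-coeff n c N) ⟩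
    inv (N !) * finiteDiff n (suc c) N - inv (N !) * finiteDiff n c N
      ≡⟨ solve 3 (λ a x y → a :* x :- a :* y := a :* (x :- y)) refl (inv (N !)) (finiteDiff n (suc c) N) (finiteDiff n c N) ⟩
    inv (N !) * (finiteDiff n (suc c) N - finiteDiff n c N)
      ≡⟨ cong (inv (N !) *_) (finiteDiff-suc n c N) ⟨
    inv (N !) * finiteDiff (suc n) c N ∎
    where
    P = psPow expm1 n

  psMul-expm1-suc : ∀ A P m → psMul A (psMul expm1 P) (suc m) ≡ psMul (psMul fPS A) P m
  psMul-expm1-suc A P m = begin
    psMul A (psMul expm1 P) (suc m) ≡⟨ psMul-lcomm A expm1 P (suc m) ⟩
    psMul expm1 (psMul A P) (suc m) ≡⟨ psMul-comm expm1 (psMul A P) (suc m) ⟩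
    psMul (psMul A P) expm1 (suc m) ≡⟨ psMul-z*-suc (psMul A P) fPS m ⟩
    psMul (psMul A P) fPS m         ≡⟨ psMul-comm (psMul A P) fPS m ⟩
    psMul fPS (psMul A P) m         ≡⟨ psMul-assoc fPS A P m ⟩
    psMul (psMul fPS A) P m         ∎

  psMul-expm1-zero : ∀ A P → psMul A (psMul expm1 P) 0 ≡ 0ℚ
  psMul-expm1-zero A P = begin
    psMul A (psMul expm1 P) 0 ≡⟨ psMul-lcomm A expm1 P 0 ⟩
    psMul expm1 (psMul A P) 0 ≡⟨ psMul-comm expm1 (psMul A P) 0 ⟩
    psMul (psMul A P) expm1 0 ≡⟨ psMul-z*-zero (psMul A P) fPS ⟩
    0ℚ                        ∎

  psMul-expm1^n-shift : ∀ n A d → psMul A (psPow expm1 n) (d ℕ.+ n) ≡ psMul A (psPow fPS n) d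
  psMul-expm1^n-shift zero A d = begin
    psMul A (psPow expm1 0) (d ℕ.+ 0) ≡⟨ psMul-pow-zeroʳ expm1 A (d ℕ.+ 0) ⟩
    A (d ℕ.+ 0)                       ≡⟨ cong A (ℕP.+-identityʳ d) ⟩
    A d                               ≡⟨ psMul-pow-zeroʳ fPS A d ⟨
    psMul A (psPow fPS 0) d           ∎
  psMul-expm1^n-shift (suc n) A d = begin
    psMul A (psMul expm1 (psPow expm1 n)) (d ℕ.+ suc n)
      ≡⟨ cong (psMul A (psMul expm1 (psPow expm1 n))) (ℕP.+-suc d n) ⟩
    psMul A (psMul expm1 (psPow expm1 n)) (suc (d ℕ.+ n))
      ≡⟨ psMul-expm1-suc A (psPow expm1 n) (d ℕ.+ n) ⟩
    psMul (psMul fPS A) (psPow expm1 n) (d ℕ.+ n)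
      ≡⟨ psMul-expm1^n-shift n (psMul fPS A) d ⟩
    psMul (psMul fPS A) (psPow fPS n) d
      ≡⟨ psMul-congʳ (psPow fPS n) (psMul-comm fPS A) d ⟩
    psMul (psMul A fPS) (psPow fPS n) d
      ≡⟨ psMul-assoc A fPS (psPow fPS n) d ⟨
    psMul A (psMul fPS (psPow fPS n)) d ∎

  psMul-expm1^n-low : ∀ n A N → N < n → psMul A (psPow expm1 n) N ≡ 0ℚ
  psMul-expm1^n-low (suc n) A zero    _         = psMul-expm1-zero A (psPow expm1 n)
  psMul-expm1^n-low (suc n) A (suc N) (s≤s N<n) =
    trans (psMul-expm1-suc A (psPow expm1 n) N) (psMul-expm1^n-low n (psMul fPS A) N N<n)

  finiteDiff-low : ∀ n c N → N < n → finiteDiff n c N ≡ 0ℚ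
  finiteDiff-low n c N N<n = begin
    finiteDiff n c N                                  ≡⟨ ℕ→ℚ*[inv*x]≡x (N !) {{N ℕP.!≢0}} (finiteDiff n c N) ⟨
    ℕ→ℚ (N !) * (inv (N !) * finiteDiff n c N)        ≡⟨ cong (ℕ→ℚ (N !) *_) (expPow*expm1^n-coeff n c N) ⟨
    ℕ→ℚ (N !) * psMul (expPow c) (psPow expm1 n) N    ≡⟨ cong (ℕ→ℚ (N !) *_) (psMul-expm1^n-low n (expPow c) N N<n) ⟩
    ℕ→ℚ (N !) * 0ℚ                                    ≡⟨ ℚP.*-zeroʳ (ℕ→ℚ (N !)) ⟩
    0ℚ                                                ∎

  exp*f^n-coeff : ∀ n r → n ≤ r → ℕ→ℚ (r !) * psMul expPS (psPow fPS n) (r ∸ n) ≡ finiteDiff n 1 r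
  exp*f^n-coeff n r n≤r = begin
    ℕ→ℚ (r !) * psMul expPS (psPow fPS n) (r ∸ n)
      ≡⟨ cong (ℕ→ℚ (r !) *_) (psMul-expm1^n-shift n expPS (r ∸ n)) ⟨
    ℕ→ℚ (r !) * psMul expPS (psPow expm1 n) (r ∸ n ℕ.+ n)
      ≡⟨ cong (λ x → ℕ→ℚ (r !) * psMul expPS (psPow expm1 n) x) (ℕP.m∸n+n≡m n≤r) ⟩
    ℕ→ℚ (r !) * psMul expPS (psPow expm1 n) r
      ≡⟨ cong (ℕ→ℚ (r !) *_) (psMul-congʳ (psPow expm1 n) expPow-one r) ⟨
    ℕ→ℚ (r !) * psMul (expPow 1) (psPow expm1 n) r
      ≡⟨ cong (ℕ→ℚ (r !) *_) (expPow*expm1^n-coeff n 1 r) ⟩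
    ℕ→ℚ (r !) * (inv (r !) * finiteDiff n 1 r)
      ≡⟨ ℕ→ℚ*[inv*x]≡x (r !) {{r ℕP.!≢0}} (finiteDiff n 1 r) ⟩
    finiteDiff n 1 r ∎

  -- The series g = z/(e^z - 1)

  fWeightedSum : ℕ → List ℚ → ℚ
  fWeightedSum j []       = 0ℚ
  fWeightedSum j (x ∷ xs) = fPS j * x + fWeightedSum (suc j) xs

  fWeightedSum-unique : {F : ℕ → List ℚ → ℚ} → (∀ j x xs → F j (x ∷ xs) ≡ fPS j * x + F (suc j) xs) →
    (∀ j → F j [] ≡ 0ℚ) → ∀ j xs → F j xs ≡ fWeightedSum j xs
  fWeightedSum-unique     F-∷ F-[] j []       = F-[] j
  fWeightedSum-unique {F} F-∷ F-[] j (x ∷ xs) =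
    trans (F-∷ j x xs) (cong (fPS j * x +_) (fWeightedSum-unique {F} F-∷ F-[] (suc j) xs))

  -- gRev sums through a helper local to Defs; unification names it as F.
  gPS-suc : ∀ k → gPS (suc k) ≡ - fWeightedSum 1 (gRev k)
  gPS-suc k with fWeightedSum-unique {F = _} (λ _ _ _ → refl) (λ _ → refl) | gRev k | 1
  ... | F≡fWeightedSum | xs | j = cong -_ (F≡fWeightedSum j xs)

  fWeightedSum-gRev : ∀ k j → fWeightedSum j (gRev k) ≡ sumTo k (λ i → fPS (j ℕ.+ i) * gPS (k ∸ i))
  fWeightedSum-gRev zero    j =
    trans (ℚP.+-identityʳ (fPS j * 1ℚ)) (cong (λ x → fPS x * 1ℚ) (sym (ℕP.+-identityʳ j)))
  fWeightedSum-gRev (suc k) j = begin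
    fPS j * gPS (suc k) + fWeightedSum (suc j) (gRev k)
      ≡⟨ cong₂ _+_ (cong (λ x → fPS x * gPS (suc k)) (sym (ℕP.+-identityʳ j)))
           (trans (fWeightedSum-gRev k (suc j)) (sumTo-cong k (λ i → cong (λ x → fPS x * gPS (k ∸ i)) (sym (ℕP.+-suc j i))))) ⟩
    fPS (j ℕ.+ 0) * gPS (suc k) + sumTo k (λ i → fPS (j ℕ.+ suc i) * gPS (k ∸ i))
      ≡⟨ sumTo-suc k (λ i → fPS (j ℕ.+ i) * gPS (suc k ∸ i)) ⟨
    sumTo (suc k) (λ i → fPS (j ℕ.+ i) * gPS (suc k ∸ i)) ∎

  f*g≈1 : psMul fPS gPS ≈ₚ psOne
  f*g≈1 zero    = refl
  f*g≈1 (suc k) = begin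
    psMul fPS gPS (suc k)
      ≡⟨ sumTo-suc k _ ⟩
    fPS 0 * gPS (suc k) + sumTo k (λ i → fPS (suc i) * gPS (k ∸ i))
      ≡⟨ cong₂ _+_ (trans (ℚP.*-identityˡ (gPS (suc k))) (gPS-suc k)) (sym (fWeightedSum-gRev k 1)) ⟩
    - fWeightedSum 1 (gRev k) + fWeightedSum 1 (gRev k)
      ≡⟨ ℚP.+-inverseˡ (fWeightedSum 1 (gRev k)) ⟩
    0ℚ ∎

  g*f≈1 : psMul gPS fPS ≈ₚ psOne
  g*f≈1 k = trans (psMul-comm gPS fPS k) (f*g≈1 k)

  psMul-cancelˡ-f : ∀ A B → psMul fPS A ≈ₚ psMul fPS B → A ≈ₚ B
  psMul-cancelˡ-f A B fA≈fB k = begin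
    A k                         ≡⟨ psMul-identityˡ A k ⟨
    psMul psOne A k             ≡⟨ psMul-congʳ A g*f≈1 k ⟨
    psMul (psMul gPS fPS) A k   ≡⟨ psMul-assoc gPS fPS A k ⟨
    psMul gPS (psMul fPS A) k   ≡⟨ psMul-congˡ gPS fA≈fB k ⟩
    psMul gPS (psMul fPS B) k   ≡⟨ psMul-assoc gPS fPS B k ⟩
    psMul (psMul gPS fPS) B k   ≡⟨ psMul-congʳ B g*f≈1 k ⟩
    psMul psOne B k             ≡⟨ psMul-identityˡ B k ⟩
    B k                         ∎

  zDeriv : PS → PS
  zDeriv A k = ℕ→ℚ k * A k

  zDeriv-psMul : ∀ A B → zDeriv (psMul A B) ≈ₚ (λ k → psMul (zDeriv A) B k + psMul A (zDeriv B) k)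
  zDeriv-psMul A B k = begin
    ℕ→ℚ k * sumTo k (λ j → A j * B (k ∸ j))
      ≡⟨ sumTo-*ˡ k (ℕ→ℚ k) _ ⟩
    sumTo k (λ j → ℕ→ℚ k * (A j * B (k ∸ j)))
      ≡⟨ sumTo-cong≤ k split ⟩
    sumTo k (λ j → ℕ→ℚ j * A j * B (k ∸ j) + A j * (ℕ→ℚ (k ∸ j) * B (k ∸ j)))
      ≡⟨ sumTo-+ k _ _ ⟩
    psMul (zDeriv A) B k + psMul A (zDeriv B) k ∎
    where
    split : ∀ j → j ≤ k → ℕ→ℚ k * (A j * B (k ∸ j)) ≡ ℕ→ℚ j * A j * B (k ∸ j) + A j * (ℕ→ℚ (k ∸ j) * B (k ∸ j))
    split j j≤k = begin
      ℕ→ℚ k * (A j * B (k ∸ j))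
        ≡⟨ cong (λ x → ℕ→ℚ x * (A j * B (k ∸ j))) (ℕP.m+[n∸m]≡n j≤k) ⟨
      ℕ→ℚ (j ℕ.+ (k ∸ j)) * (A j * B (k ∸ j))
        ≡⟨ cong (_* (A j * B (k ∸ j))) (ℕ→ℚ-+ j (k ∸ j)) ⟩
      (ℕ→ℚ j + ℕ→ℚ (k ∸ j)) * (A j * B (k ∸ j))
        ≡⟨ solve 4 (λ a b x y → (x :+ y) :* (a :* b) := x :* a :* b :+ a :* (y :* b)) refl
             (A j) (B (k ∸ j)) (ℕ→ℚ j) (ℕ→ℚ (k ∸ j)) ⟩
      ℕ→ℚ j * A j * B (k ∸ j) + A j * (ℕ→ℚ (k ∸ j) * B (k ∸ j)) ∎

  zDeriv-one : zDeriv psOne ≈ₚ (λ _ → 0ℚ)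
  zDeriv-one zero    = refl
  zDeriv-one (suc k) = ℚP.*-zeroʳ (ℕ→ℚ (suc k))

  zDeriv-f : zDeriv fPS ≈ₚ (λ k → expPS k - fPS k)
  zDeriv-f k = begin
    ℕ→ℚ k * inv (suc k !)
      ≡⟨ solve 2 (λ x c → x :* c := (x :+ con 1ℚ) :* c :- c) refl (ℕ→ℚ k) (inv (suc k !)) ⟩
    (ℕ→ℚ k + 1ℚ) * inv (suc k !) - inv (suc k !)
      ≡⟨ cong (λ x → x * inv (suc k !) - inv (suc k !)) (trans (ℚP.+-comm (ℕ→ℚ k) 1ℚ) (sym (ℕ→ℚ-+ 1 k))) ⟩
    ℕ→ℚ (suc k) * inv (suc k !) - inv (suc k !)
      ≡⟨ cong (_- inv (suc k !)) [1+k]*inv[[1+k]!]≡inv[k!] ⟩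
    inv (k !) - inv (suc k !) ∎
    where
    [1+k]*inv[[1+k]!]≡inv[k!] : ℕ→ℚ (suc k) * inv (suc k !) ≡ inv (k !)
    [1+k]*inv[[1+k]!]≡inv[k!] = begin
      ℕ→ℚ (suc k) * inv (suc k ℕ.* k !)           ≡⟨ cong (ℕ→ℚ (suc k) *_) (inv-* (suc k) (k !) {{_}} {{k ℕP.!≢0}}) ⟩
      ℕ→ℚ (suc k) * (inv (suc k) * inv (k !))     ≡⟨ ℕ→ℚ*[inv*x]≡x (suc k) (inv (k !)) ⟩
      inv (k !)                                    ∎

  exp*g : PS
  exp*g = psMul expPS gPS

  exp*g² : PS
  exp*g² = psMul expPS (psPow gPS 2)

  f*exp*g²≈exp*g : psMul fPS exp*g² ≈ₚ exp*g
  f*exp*g²≈exp*g k = begin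
    psMul fPS (psMul expPS (psMul gPS (psPow gPS 1))) k
      ≡⟨ psMul-lcomm fPS expPS (psPow gPS 2) k ⟩
    psMul expPS (psMul fPS (psMul gPS (psPow gPS 1))) k
      ≡⟨ psMul-congˡ expPS (psMul-assoc fPS gPS (psPow gPS 1)) k ⟩
    psMul expPS (psMul (psMul fPS gPS) (psPow gPS 1)) k
      ≡⟨ psMul-congˡ expPS (psMul-congʳ (psPow gPS 1) f*g≈1) k ⟩
    psMul expPS (psMul psOne (psPow gPS 1)) k
      ≡⟨ psMul-congˡ expPS (λ i → trans (psMul-identityˡ (psPow gPS 1) i) (psMul-pow-zeroʳ gPS gPS i)) k ⟩
    exp*g k ∎

  -- From z(fg)′ = 0 and z f′ = e^z - f.
  f*zDeriv-g : ∀ k → psMul fPS (zDeriv gPS) k ≡ psOne k - exp*g k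
  f*zDeriv-g k = begin
    psMul fPS (zDeriv gPS) k
      ≡⟨ solve 2 (λ x y → y := (x :+ y) :- x) refl (psMul (zDeriv fPS) gPS k) (psMul fPS (zDeriv gPS) k) ⟩
    (psMul (zDeriv fPS) gPS k + psMul fPS (zDeriv gPS) k) - psMul (zDeriv fPS) gPS k
      ≡⟨ cong₂ _-_ (sym (zDeriv-psMul fPS gPS k)) (psMul-congʳ gPS zDeriv-f k) ⟩
    zDeriv (psMul fPS gPS) k - psMul (λ i → expPS i - fPS i) gPS k
      ≡⟨ cong₂ _-_ (trans (cong (ℕ→ℚ k *_) (f*g≈1 k)) (zDeriv-one k)) (psMul-distribʳ-- gPS expPS fPS k) ⟩
    0ℚ - (exp*g k - psMul fPS gPS k)
      ≡⟨ cong (λ x → 0ℚ - (exp*g k - x)) (f*g≈1 k) ⟩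
    0ℚ - (exp*g k - psOne k)
      ≡⟨ solve 2 (λ e d → con 0ℚ :- (e :- d) := d :- e) refl (exp*g k) (psOne k) ⟩
    psOne k - exp*g k ∎

  f*[g-zDeriv-g]≈exp*g : psMul fPS (λ k → gPS k - zDeriv gPS k) ≈ₚ exp*g
  f*[g-zDeriv-g]≈exp*g k = begin
    psMul fPS (λ k → gPS k - zDeriv gPS k) k      ≡⟨ psMul-distribˡ-- fPS gPS (zDeriv gPS) k ⟩
    psMul fPS gPS k - psMul fPS (zDeriv gPS) k    ≡⟨ cong₂ _-_ (f*g≈1 k) (f*zDeriv-g k) ⟩
    psOne k - (psOne k - exp*g k)                 ≡⟨ solve 2 (λ d e → d :- (d :- e) := e) refl (psOne k) (exp*g k) ⟩
    exp*g k                                       ∎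

  exp*g²-suc : ∀ r → exp*g² (suc r) ≡ - (ℕ→ℚ r * gPS (suc r))
  exp*g²-suc r = begin
    exp*g² (suc r)
      ≡⟨ psMul-cancelˡ-f exp*g² (λ k → gPS k - zDeriv gPS k)
           (λ k → trans (f*exp*g²≈exp*g k) (sym (f*[g-zDeriv-g]≈exp*g k))) (suc r) ⟩
    gPS (suc r) - ℕ→ℚ (suc r) * gPS (suc r)
      ≡⟨ cong (λ x → gPS (suc r) - x * gPS (suc r)) (ℕ→ℚ-+ 1 r) ⟩
    gPS (suc r) - (1ℚ + ℕ→ℚ r) * gPS (suc r)
      ≡⟨ solve 2 (λ g x → g :- (con 1ℚ :+ x) :* g := :- (x :* g)) refl (gPS (suc r)) (ℕ→ℚ r) ⟩
    - (ℕ→ℚ r * gPS (suc r)) ∎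

  -- Coefficients in the Fock space

  ∧-swap : ∀ a b c → a ∧ (b ∧ c) ≡ b ∧ (a ∧ c)
  ∧-swap true  b     c = refl
  ∧-swap false true  c = refl
  ∧-swap false false c = refl

  ∧-true⇒ˡ : ∀ {a b} → a ∧ b ≡ true → a ≡ true
  ∧-true⇒ˡ {true} _ = refl

  ∧-true⇒ʳ : ∀ {a b} → a ∧ b ≡ true → b ≡ true
  ∧-true⇒ʳ {true} ab = ab

  isZero⇒≡0 : ∀ e → isZero e ≡ true → e ≡ 0
  isZero⇒≡0 zero _ = refl

  eqℕ-zeroˡ : ∀ e → eqℕ 0 e ≡ isZero e
  eqℕ-zeroˡ zero    = refl
  eqℕ-zeroˡ (suc e) = refl

  eqℕ-sym : ∀ a b → eqℕ a b ≡ eqℕ b a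
  eqℕ-sym zero    zero    = refl
  eqℕ-sym zero    (suc b) = refl
  eqℕ-sym (suc a) zero    = refl
  eqℕ-sym (suc a) (suc b) = eqℕ-sym a b

  eqℕ⇒≡ : ∀ a b → eqℕ a b ≡ true → a ≡ b
  eqℕ⇒≡ zero    zero    _  = refl
  eqℕ⇒≡ (suc a) (suc b) eq = cong suc (eqℕ⇒≡ a b eq)

  eqMono-sym : ∀ μ ν → eqMono μ ν ≡ eqMono ν μ
  eqMono-sym []      []      = refl
  eqMono-sym []      (f ∷ ν) = refl
  eqMono-sym (e ∷ μ) []      = refl
  eqMono-sym (e ∷ μ) (f ∷ ν) = cong₂ _∧_ (eqℕ-sym e f) (eqMono-sym μ ν)

  eqMono⇒expAt≡ : ∀ i μ ν → eqMono μ ν ≡ true → expAt i μ ≡ expAt i ν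
  eqMono⇒expAt≡ i       []      []      _  = refl
  eqMono⇒expAt≡ zero    []      (f ∷ ν) eq = sym (isZero⇒≡0 f (∧-true⇒ˡ {isZero f} eq))
  eqMono⇒expAt≡ (suc i) []      (f ∷ ν) eq = eqMono⇒expAt≡ i [] ν (∧-true⇒ʳ {isZero f} eq)
  eqMono⇒expAt≡ zero    (e ∷ μ) []      eq = isZero⇒≡0 e (∧-true⇒ˡ {isZero e} eq)
  eqMono⇒expAt≡ (suc i) (e ∷ μ) []      eq = eqMono⇒expAt≡ i μ [] (trans (eqMono-sym μ []) (∧-true⇒ʳ {isZero e} eq))
  eqMono⇒expAt≡ zero    (e ∷ μ) (f ∷ ν) eq = eqℕ⇒≡ e f (∧-true⇒ˡ {eqℕ e f} eq)
  eqMono⇒expAt≡ (suc i) (e ∷ μ) (f ∷ ν) eq = eqMono⇒expAt≡ i μ ν (∧-true⇒ʳ {eqℕ e f} eq)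

  allZero-incAt : ∀ i ν → allZero (incAt i ν) ≡ false
  allZero-incAt zero    []      = refl
  allZero-incAt (suc i) []      = cong (true ∧_) (allZero-incAt i [])
  allZero-incAt zero    (e ∷ ν) = refl
  allZero-incAt (suc i) (e ∷ ν) = trans (cong (isZero e ∧_) (allZero-incAt i ν)) (BoolP.∧-zeroʳ (isZero e))

  eqMono-incAt : ∀ i ν μ → eqMono (incAt i ν) μ ≡ not (isZero (expAt i μ)) ∧ eqMono ν (decAt i μ)
  eqMono-incAt zero    []      []                 = refl
  eqMono-incAt zero    []      (zero ∷ μ)         = refl
  eqMono-incAt zero    []      (suc zero ∷ μ)     = refl
  eqMono-incAt zero    []      (suc (suc e) ∷ μ)  = refl
  eqMono-incAt zero    (f ∷ ν) []                 = refl
  eqMono-incAt zero    (f ∷ ν) (zero ∷ μ)         = refl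
  eqMono-incAt zero    (f ∷ ν) (suc e ∷ μ)        = refl
  eqMono-incAt (suc i) []      []                 = allZero-incAt (suc i) []
  eqMono-incAt (suc i) (f ∷ ν) []                 = allZero-incAt (suc i) (f ∷ ν)
  eqMono-incAt (suc i) []      (e ∷ μ) = begin
    eqℕ 0 e ∧ eqMono (incAt i []) μ
      ≡⟨ cong₂ _∧_ (eqℕ-zeroˡ e) (eqMono-incAt i [] μ) ⟩
    isZero e ∧ (not (isZero (expAt i μ)) ∧ allZero (decAt i μ))
      ≡⟨ ∧-swap (isZero e) (not (isZero (expAt i μ))) (allZero (decAt i μ)) ⟩
    not (isZero (expAt i μ)) ∧ (isZero e ∧ allZero (decAt i μ)) ∎
  eqMono-incAt (suc i) (f ∷ ν) (e ∷ μ) = begin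
    eqℕ f e ∧ eqMono (incAt i ν) μ
      ≡⟨ cong (eqℕ f e ∧_) (eqMono-incAt i ν μ) ⟩
    eqℕ f e ∧ (not (isZero (expAt i μ)) ∧ eqMono ν (decAt i μ))
      ≡⟨ ∧-swap (eqℕ f e) (not (isZero (expAt i μ))) (eqMono ν (decAt i μ)) ⟩
    not (isZero (expAt i μ)) ∧ (eqℕ f e ∧ eqMono ν (decAt i μ)) ∎

  expAt-decAt : ∀ i ν → expAt i (decAt i ν) ≡ expAt i ν ∸ 1
  expAt-decAt i       []      = refl
  expAt-decAt zero    (e ∷ ν) = refl
  expAt-decAt (suc i) (e ∷ ν) = expAt-decAt i ν

  expAt-beyond-length : ∀ i ν → length ν ≤ i → expAt i ν ≡ 0
  expAt-beyond-length i       []      _         = refl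
  expAt-beyond-length (suc i) (e ∷ ν) (s≤s ν≤i) = expAt-beyond-length i ν ν≤i

  when : Bool → ℚ → ℚ
  when b c = if b then c else 0ℚ

  when-* : ∀ b q c → when b (q * c) ≡ q * when b c
  when-* true  q c = refl
  when-* false q c = sym (ℚP.*-zeroʳ q)

  when-0 : ∀ b → when b 0ℚ ≡ 0ℚ
  when-0 true  = refl
  when-0 false = refl

  coeff-++ : ∀ v w μ → coeff (v ++ w) μ ≡ coeff v μ + coeff w μ
  coeff-++ []            w μ = sym (ℚP.+-identityˡ (coeff w μ))
  coeff-++ ((c , ν) ∷ v) w μ =
    trans (cong (when (eqMono ν μ) c +_) (coeff-++ v w μ)) (sym (ℚP.+-assoc (when (eqMono ν μ) c) (coeff v μ) (coeff w μ)))

  coeff-scale : ∀ q v μ → coeff (scale q v) μ ≡ q * coeff v μ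
  coeff-scale q []            μ = sym (ℚP.*-zeroʳ q)
  coeff-scale q ((c , ν) ∷ v) μ =
    trans (cong₂ _+_ (when-* (eqMono ν μ) q c) (coeff-scale q v μ)) (sym (ℚP.*-distribˡ-+ q (when (eqMono ν μ) c) (coeff v μ)))

  creatCoeff : ℕ → (Mono → ℚ) → Mono → ℚ
  creatCoeff i φ μ = if isZero (expAt i μ) then 0ℚ else φ (decAt i μ)

  coeff-creat : ∀ i v μ → coeff (creat i v) μ ≡ creatCoeff i (coeff v) μ
  coeff-creat i [] μ with isZero (expAt i μ)
  ... | true  = refl
  ... | false = refl
  coeff-creat i ((c , ν) ∷ v) μ =
    trans (cong₂ _+_ (cong (λ b → when b c) (eqMono-incAt i ν μ)) (coeff-creat i v μ))
          (merge (isZero (expAt i μ)) (eqMono ν (decAt i μ)) (coeff v (decAt i μ)))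
    where
    merge : ∀ z b x → when (not z ∧ b) c + (if z then 0ℚ else x) ≡ (if z then 0ℚ else (when b c + x))
    merge true  b x = ℚP.+-identityˡ 0ℚ
    merge false b x = refl

  coeff-annih-term : ∀ i ν μ c → when (eqMono (decAt i ν) μ) (ℕ→ℚ (suc i) * ℕ→ℚ (expAt i ν) * c)
     ≡ ℕ→ℚ (suc i) * ℕ→ℚ (suc (expAt i μ)) * when (eqMono ν (incAt i μ)) c
  coeff-annih-term i ν μ c rewrite eqMono-sym ν (incAt i μ) | eqMono-incAt i μ ν | eqMono-sym μ (decAt i ν)
    with expAt i ν in eqe | eqMono (decAt i ν) μ in eqd
  ... | zero  | true  = trans (cong (_* c) (ℚP.*-zeroʳ (ℕ→ℚ (suc i))))
                             (trans (ℚP.*-zeroˡ c) (sym (ℚP.*-zeroʳ (ℕ→ℚ (suc i) * ℕ→ℚ (suc (expAt i μ))))))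
  ... | zero  | false = sym (ℚP.*-zeroʳ (ℕ→ℚ (suc i) * ℕ→ℚ (suc (expAt i μ))))
  ... | suc e | false = sym (ℚP.*-zeroʳ (ℕ→ℚ (suc i) * ℕ→ℚ (suc (expAt i μ))))
  ... | suc e | true  = cong (λ x → ℕ→ℚ (suc i) * ℕ→ℚ (suc x) * c)
                             (trans (sym (trans (expAt-decAt i ν) (cong (_∸ 1) eqe))) (eqMono⇒expAt≡ i (decAt i ν) μ eqd))

  coeff-annih : ∀ i v μ → coeff (annih i v) μ ≡ ℕ→ℚ (suc i) * ℕ→ℚ (suc (expAt i μ)) * coeff v (incAt i μ)
  coeff-annih i []            μ = sym (ℚP.*-zeroʳ (ℕ→ℚ (suc i) * ℕ→ℚ (suc (expAt i μ))))
  coeff-annih i ((c , ν) ∷ v) μ = begin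
    when (eqMono (decAt i ν) μ) (ℕ→ℚ (suc i) * ℕ→ℚ (expAt i ν) * c) + coeff (annih i v) μ
      ≡⟨ cong₂ _+_ (coeff-annih-term i ν μ c) (coeff-annih i v μ) ⟩
    a * when (eqMono ν (incAt i μ)) c + a * coeff v (incAt i μ)
      ≡⟨ ℚP.*-distribˡ-+ a _ _ ⟨
    a * coeff ((c , ν) ∷ v) (incAt i μ) ∎
    where a = ℕ→ℚ (suc i) * ℕ→ℚ (suc (expAt i μ))

  coeff-annih-beyond-maxLen : ∀ i v μ → maxLen v ≤ i → coeff (annih i v) μ ≡ 0ℚ
  coeff-annih-beyond-maxLen i []            μ _ = refl
  coeff-annih-beyond-maxLen i ((c , ν) ∷ v) μ ν⊔v≤i = begin
    when (eqMono (decAt i ν) μ) (ℕ→ℚ (suc i) * ℕ→ℚ (expAt i ν) * c) + coeff (annih i v) μ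
      ≡⟨ cong₂ _+_ (cong (when (eqMono (decAt i ν) μ)) term≡0)
                   (coeff-annih-beyond-maxLen i v μ (ℕP.m⊔n≤o⇒n≤o (length ν) (maxLen v) ν⊔v≤i)) ⟩
    when (eqMono (decAt i ν) μ) 0ℚ + 0ℚ
      ≡⟨ cong (_+ 0ℚ) (when-0 (eqMono (decAt i ν) μ)) ⟩
    0ℚ ∎
    where
    term≡0 : ℕ→ℚ (suc i) * ℕ→ℚ (expAt i ν) * c ≡ 0ℚ
    term≡0 rewrite expAt-beyond-length i ν (ℕP.m⊔n≤o⇒m≤o (length ν) (maxLen v) ν⊔v≤i)
      = trans (cong (_* c) (ℚP.*-zeroʳ (ℕ→ℚ (suc i)))) (ℚP.*-zeroˡ c)

  -- Residues and square-bracket modes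

  -[1+n]-[-[1+r]]≡r∸n : ∀ r n → n ≤ r → -[1+ n ] ℤ.- -[1+ r ] ≡ ℤ.+ (r ∸ n)
  -[1+n]-[-[1+r]]≡r∸n r n n≤r = trans (ℤP.[1+m]⊖[1+n]≡m⊖n r n) (ℤP.⊖-≥ n≤r)

  j⊖[1+r]≡-[1+r∸j] : ∀ r j → j ≤ r → j ⊖ suc r ≡ -[1+ (r ∸ j) ]
  j⊖[1+r]≡-[1+r∸j] r j j≤r = trans (ℤP.⊖-≤ (ℕP.m≤n⇒m≤1+n j≤r)) (cong (λ x → ℤ.- (ℤ.+ x)) (ℕP.+-∸-assoc 1 j≤r))

  resCoeff-creation : ∀ r n → n ≤ r → resCoeff -[1+ r ] -[1+ n ] ≡ psMul expPS (psPow fPS n) (r ∸ n)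
  resCoeff-creation r zero    n≤r rewrite -[1+n]-[-[1+r]]≡r∸n r zero n≤r = sym (psMul-pow-zeroʳ fPS expPS r)
  resCoeff-creation r (suc i) n≤r rewrite -[1+n]-[-[1+r]]≡r∸n r (suc i) n≤r = refl

  resCoeff-annihilation : ∀ r → resCoeff (ℤ.- (ℤ.+ r)) (ℤ.+ 1) ≡ exp*g² (suc r)
  resCoeff-annihilation r rewrite ℤP.neg-involutive (ℤ.+ r) = refl

  resCoeff[-1,-1]≡1 : resCoeff -[1+ 0 ] -[1+ 0 ] ≡ 1ℚ
  resCoeff[-1,-1]≡1 = refl

  resCoeff[-1,1]≡-1/12 : resCoeff -[1+ 0 ] (ℤ.+ 1) ≡ - inv 12
  resCoeff[-1,1]≡-1/12 = refl

  -- sqMode accumulates through a helper local to Defs; unification names it as G.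
  coeff-sqMode-steps : ∀ n v μ {G : ℕ → Fock} → G 0 ≡ scale (resCoeff n n) (mode n v) →
    (∀ k → G (suc k) ≡ G k ++ scale (resCoeff n (n ℤ.+ ℤ.+ suc k)) (mode (n ℤ.+ ℤ.+ suc k) v)) →
    ∀ k w → G k ≡ w → coeff w μ ≡ sumTo k (λ j → resCoeff n (n ℤ.+ ℤ.+ j) * coeff (mode (n ℤ.+ ℤ.+ j) v) μ)
  coeff-sqMode-steps n v μ {G} G0 Gsuc zero .(G 0) refl = begin
    coeff (G 0) μ                                       ≡⟨ cong (λ w → coeff w μ) G0 ⟩
    coeff (scale (resCoeff n n) (mode n v)) μ           ≡⟨ coeff-scale (resCoeff n n) (mode n v) μ ⟩
    resCoeff n n * coeff (mode n v) μ                   ≡⟨ cong (λ m → resCoeff n m * coeff (mode m v) μ) (ℤP.+-identityʳ n) ⟨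
    resCoeff n (n ℤ.+ ℤ.+ 0) * coeff (mode (n ℤ.+ ℤ.+ 0) v) μ ∎
  coeff-sqMode-steps n v μ {G} G0 Gsuc (suc k) .(G (suc k)) refl = begin
    coeff (G (suc k)) μ                                 ≡⟨ cong (λ w → coeff w μ) (Gsuc k) ⟩
    coeff (G k ++ scale (resCoeff n m) (mode m v)) μ    ≡⟨ coeff-++ (G k) _ μ ⟩
    coeff (G k) μ + coeff (scale (resCoeff n m) (mode m v)) μ
      ≡⟨ cong₂ _+_ (coeff-sqMode-steps n v μ {G} G0 Gsuc k (G k) refl) (coeff-scale (resCoeff n m) (mode m v) μ) ⟩
    sumTo (suc k) (λ j → resCoeff n (n ℤ.+ ℤ.+ j) * coeff (mode (n ℤ.+ ℤ.+ j) v) μ) ∎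
    where
    m = n ℤ.+ ℤ.+ suc k

  coeff-sqMode : ∀ n v μ → coeff (sqMode n v) μ ≡
    sumTo ℤ.∣ ℤ.+ maxLen v ℤ.- n ∣ (λ j → resCoeff n (n ℤ.+ ℤ.+ j) * coeff (mode (n ℤ.+ ℤ.+ j) v) μ)
  coeff-sqMode n v μ = go (sqMode n v) refl
    where
    go : ∀ w → sqMode n v ≡ w → coeff w μ ≡
      sumTo ℤ.∣ ℤ.+ maxLen v ℤ.- n ∣ (λ j → resCoeff n (n ℤ.+ ℤ.+ j) * coeff (mode (n ℤ.+ ℤ.+ j) v) μ)
    go with coeff-sqMode-steps n v μ {G = _} refl (λ _ → refl) | ℤ.∣ ℤ.+ maxLen v ℤ.- n ∣
    ... | steps | K = steps K

  OnlyX₁ : Fock → Set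
  OnlyX₁ v = ∀ i μ → coeff v (incAt (suc i) μ) ≡ 0ℚ

  coeff-mode-OnlyX₁ : ∀ v μ m → OnlyX₁ v → 2 ≤ m → coeff (mode (ℤ.+ m) v) μ ≡ 0ℚ
  coeff-mode-OnlyX₁ v μ (suc (suc i)) onlyX₁ _ = begin
    coeff (annih (suc i) v) μ                 ≡⟨ coeff-annih (suc i) v μ ⟩
    a * coeff v (incAt (suc i) μ)             ≡⟨ cong (a *_) (onlyX₁ i μ) ⟩
    a * 0ℚ                                    ≡⟨ ℚP.*-zeroʳ a ⟩
    0ℚ                                        ∎
    where a = ℕ→ℚ (suc (suc i)) * ℕ→ℚ (suc (expAt (suc i) μ))
  coeff-mode-OnlyX₁ v μ (suc zero) _ (s≤s ())

  coeff-mode-beyond-maxLen : ∀ v μ m → maxLen v < m → coeff (mode (ℤ.+ m) v) μ ≡ 0ℚ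
  coeff-mode-beyond-maxLen v μ (suc i) (s≤s v≤i) = coeff-annih-beyond-maxLen i v μ v≤i

  coeff-sqMode-OnlyX₁ : ∀ r v μ → OnlyX₁ v → coeff (sqMode -[1+ r ] v) μ ≡
    sumTo r (λ n → resCoeff -[1+ r ] -[1+ n ] * coeff (creat n v) μ)
      + resCoeff -[1+ r ] (ℤ.+ 1) * coeff (annih 0 v) μ
  coeff-sqMode-OnlyX₁ r v μ onlyX₁ = begin
    coeff (sqMode -[1+ r ] v) μ
      ≡⟨ coeff-sqMode -[1+ r ] v μ ⟩
    sumTo ℤ.∣ ℤ.+ L ℤ.- -[1+ r ] ∣ T
      ≡⟨ cong (λ x → sumTo x T) (cong ℤ.∣_∣ (sym (ℤP.pos-+ L (suc r)))) ⟩
    sumTo (L ℕ.+ suc r) T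
      ≡⟨ sumTo-vanishing-tails (L ℕ.+ suc r) (suc (suc r)) T T-beyond-maxLen T-beyond-a1 ⟩
    sumTo r T + T (suc r) + T (suc (suc r))
      ≡⟨ cong₂ (λ x y → sumTo r T + x + y) T-a0 T-a1 ⟩
    sumTo r T + 0ℚ + U (ℤ.+ 1)
      ≡⟨ cong (_+ U (ℤ.+ 1)) (trans (ℚP.+-identityʳ (sumTo r T)) T-creation) ⟩
    sumTo r (λ n → U -[1+ n ]) + U (ℤ.+ 1) ∎
    where
    L = maxLen v
    U : ℤ → ℚ
    U m = resCoeff -[1+ r ] m * coeff (mode m v) μ
    T : ℕ → ℚ
    T j = U (-[1+ r ] ℤ.+ ℤ.+ j)
    T-nonneg : ∀ j → suc r ≤ j → T j ≡ U (ℤ.+ (j ∸ suc r))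
    T-nonneg j r<j = cong U (ℤP.⊖-≥ r<j)
    U-vanish : ∀ m → coeff (mode (ℤ.+ m) v) μ ≡ 0ℚ → U (ℤ.+ m) ≡ 0ℚ
    U-vanish m a≡0 = trans (cong (resCoeff -[1+ r ] (ℤ.+ m) *_) a≡0) (ℚP.*-zeroʳ (resCoeff -[1+ r ] (ℤ.+ m)))
    T-beyond-a1 : ∀ j → suc (suc r) < j → T j ≡ 0ℚ
    T-beyond-a1 j 2+r<j = trans (T-nonneg j (ℕP.≤-trans (ℕP.n≤1+n (suc r)) (ℕP.<⇒≤ 2+r<j)))
      (U-vanish (j ∸ suc r) (coeff-mode-OnlyX₁ v μ (j ∸ suc r) onlyX₁
        (subst (_≤ j ∸ suc r) (ℕP.m+n∸n≡m 2 (suc r)) (ℕP.∸-monoˡ-≤ (suc r) 2+r<j))))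
    T-beyond-maxLen : ∀ j → L ℕ.+ suc r < j → T j ≡ 0ℚ
    T-beyond-maxLen j L+r<j = trans (T-nonneg j (ℕP.≤-trans (ℕP.m≤n+m (suc r) (suc L)) L+r<j))
      (U-vanish (j ∸ suc r) (coeff-mode-beyond-maxLen v μ (j ∸ suc r)
        (subst (_≤ j ∸ suc r) (ℕP.m+n∸n≡m (suc L) (suc r)) (ℕP.∸-monoˡ-≤ (suc r) L+r<j))))
    T-a0 : T (suc r) ≡ 0ℚ
    T-a0 = trans (cong U (ℤP.n⊖n≡0 (suc r))) (ℚP.*-zeroʳ (resCoeff -[1+ r ] (ℤ.+ 0)))
    T-a1 : T (suc (suc r)) ≡ U (ℤ.+ 1)
    T-a1 = cong U (trans (ℤP.[1+m]⊖[1+n]≡m⊖n (suc r) r)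
                  (trans (ℤP.⊖-≥ (ℕP.n≤1+n r)) (cong ℤ.+_ (ℕP.m+n∸n≡m 1 r))))
    T-creation : sumTo r T ≡ sumTo r (λ n → U -[1+ n ])
    T-creation = begin
      sumTo r T                              ≡⟨ sumTo-cong≤ r (λ j j≤r → cong U (j⊖[1+r]≡-[1+r∸j] r j j≤r)) ⟩
      sumTo r (λ j → U -[1+ r ∸ j ])         ≡⟨ sumTo-reverse r _ ⟩
      sumTo r (λ n → U -[1+ r ∸ (r ∸ n) ])   ≡⟨ sumTo-cong≤ r (λ n n≤r → cong (λ x → U -[1+ x ]) (ℕP.m∸[m∸n]≡n n≤r)) ⟩
      sumTo r (λ n → U -[1+ n ])             ∎

  -- The vector a[-1]^t 1

  -- C(t,2k)(2k)!/(2^k k!) counts the k-matchings of t points, and each matched pair contributes -1/12.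
  matchingWeight : ℕ → ℕ → ℚ
  matchingWeight t k = ℕ→ℚ (t C (2 ℕ.* k)) * ℕ→ℚ ((2 ℕ.* k) !) * inv (k !) * (((- 1ℚ) ^q k) * inv (24 ℕ.^ k))

  matchingWeight-vanish : ∀ t k → t < 2 ℕ.* k → matchingWeight t k ≡ 0ℚ
  matchingWeight-vanish t k t<2k rewrite k>n⇒nCk≡0 t<2k =
    solve 3 (λ f i s → con 0ℚ :* f :* i :* s := con 0ℚ) refl
      (ℕ→ℚ ((2 ℕ.* k) !)) (inv (k !)) (((- 1ℚ) ^q k) * inv (24 ℕ.^ k))

  2[1+k]≡2+2k : ∀ k → 2 ℕ.* suc k ≡ suc (suc (2 ℕ.* k))
  2[1+k]≡2+2k k = ℕP.*-suc 2 k

  matchingWeight-new-pair : ∀ t k →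
    ℕ→ℚ (t C suc (2 ℕ.* k)) * ℕ→ℚ (suc (suc (2 ℕ.* k)) !) * inv (suc k !) * (((- 1ℚ) ^q suc k) * inv (24 ℕ.^ suc k))
      ≡ - inv 12 * ℕ→ℚ (t ∸ 2 ℕ.* k) * matchingWeight t k
  matchingWeight-new-pair t k = begin
    Cs * F2 * inv (suc k !) * ((- 1ℚ) * p * inv (24 ℕ.^ suc k))
      ≡⟨ cong₂ (λ x y → Cs * x * y * ((- 1ℚ) * p * inv (24 ℕ.^ suc k))) F2≡ I1≡ ⟩
    Cs * (ℕ→ℚ 2 * sk * sm * F0) * (isk * I0) * ((- 1ℚ) * p * inv (24 ℕ.^ suc k))
      ≡⟨ cong (λ z → Cs * (ℕ→ℚ 2 * sk * sm * F0) * (isk * I0) * ((- 1ℚ) * p * z)) J1≡ ⟩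
    Cs * (ℕ→ℚ 2 * sk * sm * F0) * (isk * I0) * ((- 1ℚ) * p * (inv 24 * Jk))
      ≡⟨ solve 11 (λ cs two sk sm f0 isk i0 m1 p i24 j →
             cs :* (two :* sk :* sm :* f0) :* (isk :* i0) :* (m1 :* p :* (i24 :* j))
             := (sk :* isk) :* ((two :* m1 :* i24) :* (cs :* sm :* f0 :* i0 :* (p :* j))))
           refl Cs (ℕ→ℚ 2) sk sm F0 isk I0 (- 1ℚ) p (inv 24) Jk ⟩
    (sk * isk) * ((ℕ→ℚ 2 * (- 1ℚ) * inv 24) * (Cs * sm * F0 * I0 * (p * Jk)))
      ≡⟨ cong₂ (λ x y → x * ((ℕ→ℚ 2 * (- 1ℚ) * inv 24) * (y * F0 * I0 * (p * Jk))))
               (ℕ→ℚ*inv≡1 (suc k)) (sym C*[t∸2k]≡) ⟩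
    1ℚ * ((- inv 12) * (ℕ→ℚ (t C m) * ℕ→ℚ (t ∸ m) * F0 * I0 * (p * Jk)))
      ≡⟨ solve 7 (λ c a b f i p j → con 1ℚ :* (c :* (a :* b :* f :* i :* (p :* j))) := c :* b :* (a :* f :* i :* (p :* j)))
           refl (- inv 12) (ℕ→ℚ (t C m)) (ℕ→ℚ (t ∸ m)) F0 I0 p Jk ⟩
    - inv 12 * ℕ→ℚ (t ∸ m) * matchingWeight t k ∎
    where
    m = 2 ℕ.* k
    Cs = ℕ→ℚ (t C suc m)
    F0 = ℕ→ℚ (m !)
    F2 = ℕ→ℚ (suc (suc m) !)
    I0 = inv (k !)
    Jk = inv (24 ℕ.^ k)
    p = (- 1ℚ) ^q k
    sk = ℕ→ℚ (suc k)
    sm = ℕ→ℚ (suc m)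
    isk = inv (suc k)
    F2≡ : F2 ≡ ℕ→ℚ 2 * sk * sm * F0
    F2≡ = begin
      ℕ→ℚ (suc (suc m) ℕ.* (suc m ℕ.* m !))
        ≡⟨ trans (ℕ→ℚ-* (suc (suc m)) (suc m ℕ.* m !)) (cong (ℕ→ℚ (suc (suc m)) *_) (ℕ→ℚ-* (suc m) (m !))) ⟩
      ℕ→ℚ (suc (suc m)) * (sm * F0)
        ≡⟨ cong (λ x → ℕ→ℚ x * (sm * F0)) (2[1+k]≡2+2k k) ⟨
      ℕ→ℚ (2 ℕ.* suc k) * (sm * F0)
        ≡⟨ cong (_* (sm * F0)) (ℕ→ℚ-* 2 (suc k)) ⟩
      ℕ→ℚ 2 * sk * (sm * F0)
        ≡⟨ ℚP.*-assoc (ℕ→ℚ 2 * sk) sm F0 ⟨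
      ℕ→ℚ 2 * sk * sm * F0 ∎
    I1≡ : inv (suc k !) ≡ isk * I0
    I1≡ = inv-* (suc k) (k !) {{_}} {{k ℕP.!≢0}}
    J1≡ : inv (24 ℕ.^ suc k) ≡ inv 24 * Jk
    J1≡ = inv-* 24 (24 ℕ.^ k) {{_}} {{ℕP.m^n≢0 24 k}}
    C*[t∸2k]≡ : ℕ→ℚ (t C m) * ℕ→ℚ (t ∸ m) ≡ Cs * sm
    C*[t∸2k]≡ = trans (sym (ℕ→ℚ-* (t C m) (t ∸ m))) (trans (cong ℕ→ℚ (nCk*[n∸k]≡nC[1+k]*[1+k] t m)) (ℕ→ℚ-* (t C suc m) (suc m)))

  matchingWeight-suc : ∀ t k → matchingWeight (suc t) (suc k) ≡ matchingWeight t (suc k) + - inv 12 * ℕ→ℚ (t ∸ 2 ℕ.* k) * matchingWeight t k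
  matchingWeight-suc t k = begin
    matchingWeight (suc t) (suc k)
      ≡⟨ cong (λ x → ℕ→ℚ (suc t C x) * ℕ→ℚ (x !) * I * S) (2[1+k]≡2+2k k) ⟩
    ℕ→ℚ (suc t C suc (suc m)) * F * I * S
      ≡⟨ cong (λ x → ℕ→ℚ x * F * I * S) (nCk+nC[k+1]≡[n+1]C[k+1] t (suc m)) ⟨
    ℕ→ℚ (t C suc m ℕ.+ t C suc (suc m)) * F * I * S
      ≡⟨ cong (λ x → x * F * I * S) (ℕ→ℚ-+ (t C suc m) (t C suc (suc m))) ⟩
    (ℕ→ℚ (t C suc m) + ℕ→ℚ (t C suc (suc m))) * F * I * S
      ≡⟨ solve 5 (λ a b f i s → (a :+ b) :* f :* i :* s := b :* f :* i :* s :+ a :* f :* i :* s)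
           refl (ℕ→ℚ (t C suc m)) (ℕ→ℚ (t C suc (suc m))) F I S ⟩
    ℕ→ℚ (t C suc (suc m)) * F * I * S + ℕ→ℚ (t C suc m) * F * I * S
      ≡⟨ cong₂ _+_ (cong (λ x → ℕ→ℚ (t C x) * ℕ→ℚ (x !) * I * S) (2[1+k]≡2+2k k)) (sym (matchingWeight-new-pair t k)) ⟨
    matchingWeight t (suc k) + - inv 12 * ℕ→ℚ (t ∸ m) * matchingWeight t k ∎
    where
    m = 2 ℕ.* k
    F = ℕ→ℚ (suc (suc m) !)
    I = inv (suc k !)
    S = ((- 1ℚ) ^q suc k) * inv (24 ℕ.^ suc k)

  x₁^ : ℕ → Mono → ℚ
  x₁^ j μ = coeff (a-1^ j vac) μ

  a-1^-vac : ∀ j → a-1^ (suc j) vac ≡ (1ℚ , suc j ∷ []) ∷ []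
  a-1^-vac zero = refl
  a-1^-vac (suc j) rewrite a-1^-vac j = refl

  x₁^-indicator : ∀ j μ → x₁^ j μ ≡ when (eqMono (j ∷ []) μ) 1ℚ
  x₁^-indicator zero    μ = trans (ℚP.+-identityʳ (when (eqMono [] μ) 1ℚ)) (cong (λ b → when b 1ℚ) (eqMono-[]≡[0] μ))
    where
    eqMono-[]≡[0] : ∀ μ → eqMono [] μ ≡ eqMono (0 ∷ []) μ
    eqMono-[]≡[0] []      = refl
    eqMono-[]≡[0] (e ∷ μ) = cong (_∧ allZero μ) (sym (eqℕ-zeroˡ e))
  x₁^-indicator (suc j) μ rewrite a-1^-vac j = ℚP.+-identityʳ (when (eqMono (suc j ∷ []) μ) 1ℚ)

  x₁^-OnlyX₁ : ∀ j i μ → x₁^ j (incAt (suc i) μ) ≡ 0ℚ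
  x₁^-OnlyX₁ j i μ
    rewrite x₁^-indicator j (incAt (suc i) μ) | eqMono-sym (j ∷ []) (incAt (suc i) μ) | eqMono-incAt (suc i) μ (j ∷ []) = refl

  coeff-a1-x₁^ : ∀ j μ → ℕ→ℚ 1 * ℕ→ℚ (suc (expAt 0 μ)) * x₁^ j (incAt 0 μ) ≡ ℕ→ℚ j * x₁^ (j ∸ 1) μ
  coeff-a1-x₁^ zero μ
    rewrite x₁^-indicator 0 (incAt 0 μ) | eqMono-sym (0 ∷ []) (incAt 0 μ) | eqMono-incAt 0 μ (0 ∷ []) =
    trans (ℚP.*-zeroʳ (ℕ→ℚ 1 * ℕ→ℚ (suc (expAt 0 μ)))) (sym (ℚP.*-zeroˡ (x₁^ 0 μ)))
  coeff-a1-x₁^ (suc j) μ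
    rewrite x₁^-indicator (suc j) (incAt 0 μ) | eqMono-sym (suc j ∷ []) (incAt 0 μ) | eqMono-incAt 0 μ (suc j ∷ [])
          | x₁^-indicator j μ | eqMono-sym (j ∷ []) μ
    with eqMono μ (j ∷ []) in μ≡x₁^j
  ... | true  rewrite eqMono⇒expAt≡ 0 μ (j ∷ []) μ≡x₁^j =
    solve 1 (λ x → con 1ℚ :* x :* con 1ℚ := x :* con 1ℚ) refl (ℕ→ℚ (suc j))
  ... | false = trans (ℚP.*-zeroʳ (ℕ→ℚ 1 * ℕ→ℚ (suc (expAt 0 μ)))) (sym (ℚP.*-zeroʳ (ℕ→ℚ (suc j))))

  sqA-1^Coeff : ℕ → Mono → ℚ
  sqA-1^Coeff t μ = sumTo t (λ k → matchingWeight t k * x₁^ (t ∸ 2 ℕ.* k) μ)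

  sqA-1^Coeff-OnlyX₁ : ∀ t v → (∀ μ → coeff v μ ≡ sqA-1^Coeff t μ) → OnlyX₁ v
  sqA-1^Coeff-OnlyX₁ t v v≡ i μ = trans (v≡ (incAt (suc i) μ))
    (sumTo-zero t _ (λ k _ → trans (cong (matchingWeight t k *_) (x₁^-OnlyX₁ (t ∸ 2 ℕ.* k) i μ)) (ℚP.*-zeroʳ (matchingWeight t k))))

  if-sumTo : ∀ z t (A B : ℕ → ℚ) →
    (if z then 0ℚ else sumTo t (λ k → A k * B k)) ≡ sumTo t (λ k → A k * (if z then 0ℚ else B k))
  if-sumTo true  t A B = sym (sumTo-zero t _ (λ k _ → ℚP.*-zeroʳ (A k)))
  if-sumTo false t A B = refl

  creatCoeff-sqA-1^Coeff : ∀ t n μ → creatCoeff n (sqA-1^Coeff t) μ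
    ≡ sumTo t (λ k → matchingWeight t k * coeff (creat n (a-1^ (t ∸ 2 ℕ.* k) vac)) μ)
  creatCoeff-sqA-1^Coeff t n μ = begin
    (if isZero (expAt n μ) then 0ℚ else sqA-1^Coeff t (decAt n μ))
      ≡⟨ if-sumTo (isZero (expAt n μ)) t (matchingWeight t) (λ k → x₁^ (t ∸ 2 ℕ.* k) (decAt n μ)) ⟩
    sumTo t (λ k → matchingWeight t k * creatCoeff n (x₁^ (t ∸ 2 ℕ.* k)) μ)
      ≡⟨ sumTo-cong t (λ k → cong (matchingWeight t k *_) (sym (coeff-creat n (a-1^ (t ∸ 2 ℕ.* k) vac) μ))) ⟩
    sumTo t (λ k → matchingWeight t k * coeff (creat n (a-1^ (t ∸ 2 ℕ.* k) vac)) μ) ∎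

  coeff-annih-sqA-1^Coeff : ∀ t v μ → (∀ μ → coeff v μ ≡ sqA-1^Coeff t μ) →
    coeff (annih 0 v) μ ≡ sumTo t (λ k → matchingWeight t k * (ℕ→ℚ (t ∸ 2 ℕ.* k) * x₁^ (t ∸ 2 ℕ.* k ∸ 1) μ))
  coeff-annih-sqA-1^Coeff t v μ v≡ = begin
    coeff (annih 0 v) μ
      ≡⟨ coeff-annih 0 v μ ⟩
    a * coeff v (incAt 0 μ)
      ≡⟨ cong (a *_) (v≡ (incAt 0 μ)) ⟩
    a * sqA-1^Coeff t (incAt 0 μ)
      ≡⟨ sumTo-*ˡ t a _ ⟩
    sumTo t (λ k → a * (matchingWeight t k * x₁^ (t ∸ 2 ℕ.* k) (incAt 0 μ)))
      ≡⟨ sumTo-cong t (λ k → trans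
           (solve 3 (λ a h w → a :* (h :* w) := h :* (a :* w)) refl a (matchingWeight t k) (x₁^ (t ∸ 2 ℕ.* k) (incAt 0 μ)))
           (cong (matchingWeight t k *_) (coeff-a1-x₁^ (t ∸ 2 ℕ.* k) μ))) ⟩
    sumTo t (λ k → matchingWeight t k * (ℕ→ℚ (t ∸ 2 ℕ.* k) * x₁^ (t ∸ 2 ℕ.* k ∸ 1) μ)) ∎
    where a = ℕ→ℚ 1 * ℕ→ℚ (suc (expAt 0 μ))

  sumTo-matching-shift : ∀ t μ → sumTo t (λ k → matchingWeight t k * x₁^ (suc (t ∸ 2 ℕ.* k)) μ)
     ≡ matchingWeight t 0 * x₁^ (suc t) μ + sumTo t (λ k → matchingWeight t (suc k) * x₁^ (suc t ∸ 2 ℕ.* suc k) μ)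
  sumTo-matching-shift t μ = begin
    sumTo t F
      ≡⟨ sumTo-vanishing-tail t (suc t) F (ℕP.n≤1+n t) F-vanish ⟨
    sumTo (suc t) F
      ≡⟨ sumTo-suc t F ⟩
    F 0 + sumTo t (λ k → F (suc k))
      ≡⟨ cong (F 0 +_) (sumTo-cong t F-suc) ⟩
    matchingWeight t 0 * x₁^ (suc t) μ + sumTo t (λ k → matchingWeight t (suc k) * x₁^ (suc t ∸ 2 ℕ.* suc k) μ) ∎
    where
    F : ℕ → ℚ
    F k = matchingWeight t k * x₁^ (suc (t ∸ 2 ℕ.* k)) μ
    F-vanish : ∀ i → t < i → F i ≡ 0ℚ
    F-vanish i t<i = trans (cong (_* x₁^ (suc (t ∸ 2 ℕ.* i)) μ) (matchingWeight-vanish t i (ℕP.<-≤-trans t<i (ℕP.m≤n*m i 2))))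
                           (ℚP.*-zeroˡ (x₁^ (suc (t ∸ 2 ℕ.* i)) μ))
    F-suc : ∀ k → F (suc k) ≡ matchingWeight t (suc k) * x₁^ (suc t ∸ 2 ℕ.* suc k) μ
    F-suc k with 2 ℕ.* suc k ℕ.≤? t
    ... | yes 2k≤t = cong (λ x → matchingWeight t (suc k) * x₁^ x μ) (sym (ℕP.+-∸-assoc 1 2k≤t))
    ... | no  2k≰t rewrite matchingWeight-vanish t (suc k) (ℕP.≰⇒> 2k≰t) =
      trans (ℚP.*-zeroˡ (x₁^ (suc (t ∸ 2 ℕ.* suc k)) μ)) (sym (ℚP.*-zeroˡ (x₁^ (suc t ∸ 2 ℕ.* suc k) μ)))

  matchingWeight-recursion-sum : ∀ t μ →
    sumTo t (λ k → matchingWeight t (suc k) * x₁^ (suc t ∸ 2 ℕ.* suc k) μ)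
      + - inv 12 * sumTo t (λ k → matchingWeight t k * (ℕ→ℚ (t ∸ 2 ℕ.* k) * x₁^ (suc t ∸ 2 ℕ.* suc k) μ))
    ≡ sumTo t (λ k → matchingWeight (suc t) (suc k) * x₁^ (suc t ∸ 2 ℕ.* suc k) μ)
  matchingWeight-recursion-sum t μ = begin
    Σ₁ + - inv 12 * Σ₂
      ≡⟨ cong (Σ₁ +_) (sumTo-*ˡ t (- inv 12) _) ⟩
    Σ₁ + sumTo t (λ k → - inv 12 * (matchingWeight t k * (ℕ→ℚ (t ∸ 2 ℕ.* k) * w k)))
      ≡⟨ sumTo-+ t _ _ ⟨
    sumTo t (λ k → matchingWeight t (suc k) * w k + - inv 12 * (matchingWeight t k * (ℕ→ℚ (t ∸ 2 ℕ.* k) * w k)))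
      ≡⟨ sumTo-cong t (λ k → trans
           (solve 4 (λ a b d x → a :* x :+ con (- inv 12) :* (b :* (d :* x)) := (a :+ con (- inv 12) :* d :* b) :* x) refl
              (matchingWeight t (suc k)) (matchingWeight t k) (ℕ→ℚ (t ∸ 2 ℕ.* k)) (w k))
           (cong (_* w k) (sym (matchingWeight-suc t k)))) ⟩
    sumTo t (λ k → matchingWeight (suc t) (suc k) * w k) ∎
    where
    w : ℕ → ℚ
    w k = x₁^ (suc t ∸ 2 ℕ.* suc k) μ
    Σ₁ = sumTo t (λ k → matchingWeight t (suc k) * w k)
    Σ₂ = sumTo t (λ k → matchingWeight t k * (ℕ→ℚ (t ∸ 2 ℕ.* k) * w k))

  coeff-sqA-1^ : ∀ t μ → coeff (sqA-1^ t) μ ≡ sqA-1^Coeff t μ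
  coeff-sqA-1^ zero    μ = sym (ℚP.*-identityˡ (x₁^ 0 μ))
  coeff-sqA-1^ (suc t) μ = begin
    coeff (sqMode -[1+ 0 ] P) μ
      ≡⟨ coeff-sqMode-OnlyX₁ 0 P μ (sqA-1^Coeff-OnlyX₁ t P ih) ⟩
    resCoeff -[1+ 0 ] -[1+ 0 ] * coeff (creat 0 P) μ + resCoeff -[1+ 0 ] (ℤ.+ 1) * coeff (annih 0 P) μ
      ≡⟨ cong₂ _+_ (cong₂ _*_ resCoeff[-1,-1]≡1 (trans (coeff-creat 0 P μ) creat-P))
                   (cong₂ _*_ resCoeff[-1,1]≡-1/12 (coeff-annih-sqA-1^Coeff t P μ ih)) ⟩
    1ℚ * Σcreat + - inv 12 * Σannih
      ≡⟨ cong₂ (λ x y → 1ℚ * x + - inv 12 * y) (sumTo-matching-shift t μ) (sumTo-cong t annih-index) ⟩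
    1ℚ * (1ℚ * x₁^ (suc t) μ + Σ₁) + - inv 12 * Σ₂
      ≡⟨ solve 3 (λ a s₁ s₂ → con 1ℚ :* (con 1ℚ :* a :+ s₁) :+ con (- inv 12) :* s₂ := con 1ℚ :* a :+ (s₁ :+ con (- inv 12) :* s₂))
           refl (x₁^ (suc t) μ) Σ₁ Σ₂ ⟩
    1ℚ * x₁^ (suc t) μ + (Σ₁ + - inv 12 * Σ₂)
      ≡⟨ cong (1ℚ * x₁^ (suc t) μ +_) (matchingWeight-recursion-sum t μ) ⟩
    G 0 + sumTo t (λ k → G (suc k))
      ≡⟨ sumTo-suc t G ⟨
    sqA-1^Coeff (suc t) μ ∎
    where
    P = sqA-1^ t
    ih = coeff-sqA-1^ t
    G : ℕ → ℚ
    G k = matchingWeight (suc t) k * x₁^ (suc t ∸ 2 ℕ.* k) μ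
    Σcreat = sumTo t (λ k → matchingWeight t k * x₁^ (suc (t ∸ 2 ℕ.* k)) μ)
    Σannih = sumTo t (λ k → matchingWeight t k * (ℕ→ℚ (t ∸ 2 ℕ.* k) * x₁^ (t ∸ 2 ℕ.* k ∸ 1) μ))
    Σ₁ = sumTo t (λ k → matchingWeight t (suc k) * x₁^ (suc t ∸ 2 ℕ.* suc k) μ)
    Σ₂ = sumTo t (λ k → matchingWeight t k * (ℕ→ℚ (t ∸ 2 ℕ.* k) * x₁^ (suc t ∸ 2 ℕ.* suc k) μ))
    creat-P : creatCoeff 0 (coeff P) μ ≡ Σcreat
    creat-P = begin
      (if isZero (expAt 0 μ) then 0ℚ else coeff P (decAt 0 μ))
        ≡⟨ cong (λ x → if isZero (expAt 0 μ) then 0ℚ else x) (ih (decAt 0 μ)) ⟩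
      creatCoeff 0 (sqA-1^Coeff t) μ
        ≡⟨ creatCoeff-sqA-1^Coeff t 0 μ ⟩
      Σcreat ∎
    annih-index : ∀ k → matchingWeight t k * (ℕ→ℚ (t ∸ 2 ℕ.* k) * x₁^ (t ∸ 2 ℕ.* k ∸ 1) μ)
                      ≡ matchingWeight t k * (ℕ→ℚ (t ∸ 2 ℕ.* k) * x₁^ (suc t ∸ 2 ℕ.* suc k) μ)
    annih-index k = cong (λ x → matchingWeight t k * (ℕ→ℚ (t ∸ 2 ℕ.* k) * x₁^ x μ))
      (trans (ℕP.∸-+-assoc t (2 ℕ.* k) 1) (trans (cong (t ∸_) (ℕP.+-comm (2 ℕ.* k) 1)) (cong (suc t ∸_) (sym (2[1+k]≡2+2k k)))))

  creationTerm : ℕ → ℕ → Mono → ℕ → ℚ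
  creationTerm r t μ n = finiteDiff n 1 r * sumTo t (λ k → matchingWeight t k * coeff (creat n (a-1^ (t ∸ 2 ℕ.* k) vac)) μ)

  creation-lhs : ∀ r t μ → ℕ→ℚ (r !) * sumTo r (λ n → resCoeff -[1+ r ] -[1+ n ] * coeff (creat n (sqA-1^ t)) μ)
    ≡ sumTo r (creationTerm r t μ)
  creation-lhs r t μ = begin
    ℕ→ℚ (r !) * sumTo r (λ n → resCoeff -[1+ r ] -[1+ n ] * coeff (creat n (sqA-1^ t)) μ)
      ≡⟨ sumTo-*ˡ r (ℕ→ℚ (r !)) _ ⟩
    sumTo r (λ n → ℕ→ℚ (r !) * (resCoeff -[1+ r ] -[1+ n ] * coeff (creat n (sqA-1^ t)) μ))
      ≡⟨ sumTo-cong≤ r term ⟩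
    sumTo r (creationTerm r t μ) ∎
    where
    creat-sqA-1^ : ∀ n → coeff (creat n (sqA-1^ t)) μ
      ≡ sumTo t (λ k → matchingWeight t k * coeff (creat n (a-1^ (t ∸ 2 ℕ.* k) vac)) μ)
    creat-sqA-1^ n = begin
      coeff (creat n (sqA-1^ t)) μ        ≡⟨ coeff-creat n (sqA-1^ t) μ ⟩
      (if isZero (expAt n μ) then 0ℚ else coeff (sqA-1^ t) (decAt n μ))
        ≡⟨ cong (λ x → if isZero (expAt n μ) then 0ℚ else x) (coeff-sqA-1^ t (decAt n μ)) ⟩
      creatCoeff n (sqA-1^Coeff t) μ      ≡⟨ creatCoeff-sqA-1^Coeff t n μ ⟩
      sumTo t (λ k → matchingWeight t k * coeff (creat n (a-1^ (t ∸ 2 ℕ.* k) vac)) μ) ∎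
    term : ∀ n → n ≤ r → ℕ→ℚ (r !) * (resCoeff -[1+ r ] -[1+ n ] * coeff (creat n (sqA-1^ t)) μ) ≡ creationTerm r t μ n
    term n n≤r = trans (sym (ℚP.*-assoc (ℕ→ℚ (r !)) _ _))
      (cong₂ _*_ (trans (cong (ℕ→ℚ (r !) *_) (resCoeff-creation r n n≤r)) (exp*f^n-coeff n r n≤r)) (creat-sqA-1^ n))

  -- stirling (suc r) n unfolds to inv (n !) * finiteDiff n 1 r.
  creation-rhs : ∀ r t μ → sumTo (length μ) (λ n → sumTo t (λ k →
        ℕ→ℚ (t C (2 ℕ.* k)) * ℕ→ℚ (n !) * stirling (suc r) n * ℕ→ℚ ((2 ℕ.* k) !)
          * inv (k !) * (((- 1ℚ) ^q k) * inv (24 ℕ.^ k))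
          * coeff (creat n (a-1^ (t ∸ 2 ℕ.* k) vac)) μ)) ≡ sumTo (length μ) (creationTerm r t μ)
  creation-rhs r t μ = sumTo-cong (length μ) (λ n → begin
    sumTo t (λ k → ℕ→ℚ (t C (2 ℕ.* k)) * ℕ→ℚ (n !) * stirling (suc r) n * ℕ→ℚ ((2 ℕ.* k) !)
          * inv (k !) * (((- 1ℚ) ^q k) * inv (24 ℕ.^ k)) * X n k)
      ≡⟨ sumTo-cong t (λ k → solve 7 (λ c nf s f i q x → c :* nf :* s :* f :* i :* q :* x := (nf :* s) :* (c :* f :* i :* q :* x)) refl
            (ℕ→ℚ (t C (2 ℕ.* k))) (ℕ→ℚ (n !)) (stirling (suc r) n) (ℕ→ℚ ((2 ℕ.* k) !)) (inv (k !))
            (((- 1ℚ) ^q k) * inv (24 ℕ.^ k)) (X n k)) ⟩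
    sumTo t (λ k → (ℕ→ℚ (n !) * stirling (suc r) n) * (matchingWeight t k * X n k))
      ≡⟨ sumTo-*ˡ t (ℕ→ℚ (n !) * stirling (suc r) n) (λ k → matchingWeight t k * X n k) ⟨
    (ℕ→ℚ (n !) * stirling (suc r) n) * sumTo t (λ k → matchingWeight t k * X n k)
      ≡⟨ cong (_* sumTo t (λ k → matchingWeight t k * X n k)) (ℕ→ℚ*[inv*x]≡x (n !) {{n ℕP.!≢0}} (finiteDiff n 1 r)) ⟩
    creationTerm r t μ n ∎)
    where
    X : ℕ → ℕ → ℚ
    X n k = coeff (creat n (a-1^ (t ∸ 2 ℕ.* k) vac)) μ

  creation-range : ∀ r t μ → sumTo r (creationTerm r t μ) ≡ sumTo (length μ) (creationTerm r t μ)
  creation-range r t μ = sumTo-vanishing-tails r (length μ) (creationTerm r t μ) beyond-r beyond-length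
    where
    Σ : ℕ → ℚ
    Σ n = sumTo t (λ k → matchingWeight t k * coeff (creat n (a-1^ (t ∸ 2 ℕ.* k) vac)) μ)
    beyond-r : ∀ n → r < n → creationTerm r t μ n ≡ 0ℚ
    beyond-r n r<n = trans (cong (_* Σ n) (finiteDiff-low n 1 r r<n)) (ℚP.*-zeroˡ (Σ n))
    creat-beyond-length : ∀ n k → length μ ≤ n → coeff (creat n (a-1^ (t ∸ 2 ℕ.* k) vac)) μ ≡ 0ℚ
    creat-beyond-length n k μ≤n rewrite coeff-creat n (a-1^ (t ∸ 2 ℕ.* k) vac) μ | expAt-beyond-length n μ μ≤n = refl
    beyond-length : ∀ n → length μ < n → creationTerm r t μ n ≡ 0ℚ
    beyond-length n μ<n = trans
      (cong (finiteDiff n 1 r *_) (sumTo-zero t _ (λ k _ →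
        trans (cong (matchingWeight t k *_) (creat-beyond-length n k (ℕP.<⇒≤ μ<n))) (ℚP.*-zeroʳ (matchingWeight t k)))))
      (ℚP.*-zeroʳ (finiteDiff n 1 r))

  annihTerm : ℕ → ℕ → Mono → ℚ
  annihTerm t k μ = ℕ→ℚ (t C suc (2 ℕ.* k)) * ℕ→ℚ (suc (2 ℕ.* k) !) * inv (k !) * (((- 1ℚ) ^q k) * inv (24 ℕ.^ k))
                    * x₁^ (t ∸ suc (2 ℕ.* k)) μ

  matchingWeight-a1 : ∀ t k μ → matchingWeight t k * (ℕ→ℚ (t ∸ 2 ℕ.* k) * x₁^ (t ∸ 2 ℕ.* k ∸ 1) μ) ≡ annihTerm t k μ
  matchingWeight-a1 t k μ = begin
    ℕ→ℚ (t C m) * Fm * I * Q * (ℕ→ℚ (t ∸ m) * x₁^ (t ∸ m ∸ 1) μ)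
      ≡⟨ cong (λ x → ℕ→ℚ (t C m) * Fm * I * Q * (ℕ→ℚ (t ∸ m) * x₁^ x μ))
              (trans (ℕP.∸-+-assoc t m 1) (cong (t ∸_) (ℕP.+-comm m 1))) ⟩
    ℕ→ℚ (t C m) * Fm * I * Q * (ℕ→ℚ (t ∸ m) * w)
      ≡⟨ solve 6 (λ c f i q d w → c :* f :* i :* q :* (d :* w) := (c :* d) :* f :* i :* q :* w) refl
           (ℕ→ℚ (t C m)) Fm I Q (ℕ→ℚ (t ∸ m)) w ⟩
    (ℕ→ℚ (t C m) * ℕ→ℚ (t ∸ m)) * Fm * I * Q * w
      ≡⟨ cong (λ x → x * Fm * I * Q * w)
              (trans (sym (ℕ→ℚ-* (t C m) (t ∸ m))) (trans (cong ℕ→ℚ (nCk*[n∸k]≡nC[1+k]*[1+k] t m)) (ℕ→ℚ-* (t C suc m) (suc m)))) ⟩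
    (ℕ→ℚ (t C suc m) * ℕ→ℚ (suc m)) * Fm * I * Q * w
      ≡⟨ solve 6 (λ c s f i q w → (c :* s) :* f :* i :* q :* w := c :* (s :* f) :* i :* q :* w) refl
           (ℕ→ℚ (t C suc m)) (ℕ→ℚ (suc m)) Fm I Q w ⟩
    ℕ→ℚ (t C suc m) * (ℕ→ℚ (suc m) * Fm) * I * Q * w
      ≡⟨ cong (λ x → ℕ→ℚ (t C suc m) * x * I * Q * w) (ℕ→ℚ-* (suc m) (m !)) ⟨
    annihTerm t k μ ∎
    where
    m = 2 ℕ.* k
    Fm = ℕ→ℚ (m !)
    I = inv (k !)
    Q = ((- 1ℚ) ^q k) * inv (24 ℕ.^ k)
    w = x₁^ (t ∸ suc m) μ

  annihilation-lhs : ∀ r t μ → ℕ→ℚ (r !) * (resCoeff -[1+ r ] (ℤ.+ 1) * coeff (annih 0 (sqA-1^ t)) μ)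
     ≡ - (ℕ→ℚ (suc r !) * gPS (suc (suc r)) * sumTo t (λ k → annihTerm t k μ))
  annihilation-lhs r t μ = begin
    ℕ→ℚ (r !) * (resCoeff -[1+ r ] (ℤ.+ 1) * coeff (annih 0 (sqA-1^ t)) μ)
      ≡⟨ cong₂ (λ x y → ℕ→ℚ (r !) * (x * y)) (trans (resCoeff-annihilation (suc r)) (exp*g²-suc (suc r)))
           (trans (coeff-annih-sqA-1^Coeff t (sqA-1^ t) μ (coeff-sqA-1^ t)) (sumTo-cong t (λ k → matchingWeight-a1 t k μ))) ⟩
    ℕ→ℚ (r !) * (- (ℕ→ℚ (suc r) * g) * Z)
      ≡⟨ solve 4 (λ a b g z → a :* (:- (b :* g) :* z) := :- ((b :* a) :* g :* z)) refl (ℕ→ℚ (r !)) (ℕ→ℚ (suc r)) g Z ⟩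
    - ((ℕ→ℚ (suc r) * ℕ→ℚ (r !)) * g * Z)
      ≡⟨ cong (λ x → - (x * g * Z)) (ℕ→ℚ-* (suc r) (r !)) ⟨
    - (ℕ→ℚ (suc r !) * g * Z) ∎
    where
    g = gPS (suc (suc r))
    Z = sumTo t (λ k → annihTerm t k μ)

  -- bernoulli (2 + r) unfolds to (2 + r)! · g_{2+r}, and (2 + r) · inv (2 + r) cancels.
  annihilation-rhs : ∀ r t μ → sumTo t (λ k →
        ℕ→ℚ (t C suc (2 ℕ.* k)) * bernoulli (suc (suc r)) * ℕ→ℚ (suc (2 ℕ.* k) !)
          * inv (k !) * inv (suc (suc r)) * (((- 1ℚ) ^q k) * inv (24 ℕ.^ k))
          * coeff (a-1^ (t ∸ suc (2 ℕ.* k)) vac) μ)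
     ≡ ℕ→ℚ (suc r !) * gPS (suc (suc r)) * sumTo t (λ k → annihTerm t k μ)
  annihilation-rhs r t μ = begin
    sumTo t (λ k → ℕ→ℚ (t C suc (2 ℕ.* k)) * (ℕ→ℚ (2+r ℕ.* suc r !) * g) * ℕ→ℚ (suc (2 ℕ.* k) !)
          * inv (k !) * inv 2+r * Q k * x₁^ (t ∸ suc (2 ℕ.* k)) μ)
      ≡⟨ sumTo-cong t term ⟩
    sumTo t (λ k → ℕ→ℚ (suc r !) * g * annihTerm t k μ)
      ≡⟨ sumTo-*ˡ t (ℕ→ℚ (suc r !) * g) (λ k → annihTerm t k μ) ⟨
    ℕ→ℚ (suc r !) * g * sumTo t (λ k → annihTerm t k μ) ∎
    where
    2+r = suc (suc r)
    g = gPS 2+r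
    Q : ℕ → ℚ
    Q k = ((- 1ℚ) ^q k) * inv (24 ℕ.^ k)
    term : ∀ k → ℕ→ℚ (t C suc (2 ℕ.* k)) * (ℕ→ℚ (2+r ℕ.* suc r !) * g) * ℕ→ℚ (suc (2 ℕ.* k) !)
                   * inv (k !) * inv 2+r * Q k * x₁^ (t ∸ suc (2 ℕ.* k)) μ
               ≡ ℕ→ℚ (suc r !) * g * annihTerm t k μ
    term k = begin
      Ct * (ℕ→ℚ (2+r ℕ.* suc r !) * g) * F * I * inv 2+r * Q k * w
        ≡⟨ cong (λ x → Ct * (x * g) * F * I * inv 2+r * Q k * w) (ℕ→ℚ-* 2+r (suc r !)) ⟩
      Ct * (ℕ→ℚ 2+r * ℕ→ℚ (suc r !) * g) * F * I * inv 2+r * Q k * w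
        ≡⟨ solve 9 (λ c s n g f i v q w → c :* (s :* n :* g) :* f :* i :* v :* q :* w := (s :* v) :* (n :* g :* (c :* f :* i :* q :* w)))
             refl Ct (ℕ→ℚ 2+r) (ℕ→ℚ (suc r !)) g F I (inv 2+r) (Q k) w ⟩
      (ℕ→ℚ 2+r * inv 2+r) * (ℕ→ℚ (suc r !) * g * annihTerm t k μ)
        ≡⟨ cong (_* (ℕ→ℚ (suc r !) * g * annihTerm t k μ)) (ℕ→ℚ*inv≡1 2+r) ⟩
      1ℚ * (ℕ→ℚ (suc r !) * g * annihTerm t k μ)
        ≡⟨ ℚP.*-identityˡ _ ⟩
      ℕ→ℚ (suc r !) * g * annihTerm t k μ ∎
      where
      Ct = ℕ→ℚ (t C suc (2 ℕ.* k))
      F = ℕ→ℚ (suc (2 ℕ.* k) !)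
      I = inv (k !)
      w = x₁^ (t ∸ suc (2 ℕ.* k)) μ

  coeff-vrt : ∀ r t μ → coeff (vrt (suc r) t) μ ≡ rhsCoeff (suc r) t μ
  coeff-vrt r t μ = begin
    coeff (scale (ℕ→ℚ (r !)) (sqMode -[1+ r ] P)) μ
      ≡⟨ coeff-scale (ℕ→ℚ (r !)) (sqMode -[1+ r ] P) μ ⟩
    ℕ→ℚ (r !) * coeff (sqMode -[1+ r ] P) μ
      ≡⟨ cong (ℕ→ℚ (r !) *_) (coeff-sqMode-OnlyX₁ r P μ (sqA-1^Coeff-OnlyX₁ t P (coeff-sqA-1^ t))) ⟩
    ℕ→ℚ (r !) * (creations + annihilation)
      ≡⟨ ℚP.*-distribˡ-+ (ℕ→ℚ (r !)) creations annihilation ⟩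
    ℕ→ℚ (r !) * creations + ℕ→ℚ (r !) * annihilation
      ≡⟨ cong₂ _+_ (trans (creation-lhs r t μ) (trans (creation-range r t μ) (sym (creation-rhs r t μ))))
                   (trans (annihilation-lhs r t μ) (cong -_ (sym (annihilation-rhs r t μ)))) ⟩
    rhsCoeff (suc r) t μ ∎
    where
    P = sqA-1^ t
    creations = sumTo r (λ n → resCoeff -[1+ r ] -[1+ n ] * coeff (creat n P) μ)
    annihilation = resCoeff -[1+ r ] (ℤ.+ 1) * coeff (annih 0 P) μ


open import Data.Nat using (ℕ; suc; _≤_; _+_; _*_; s≤s)
open import Data.Product using (∃)
open import Relation.Binary.PropositionalEquality using (_≡_)

proposition4p1 : (r t : ℕ) → ∃ (λ i → r ≡ 2 * i + 1) → ∃ (λ j → t ≡ 2 * j + 1) →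
    1 ≤ t → 3 ≤ r → (μ : Mono) → coeff (vrt r t) μ ≡ rhsCoeff r t μ
proposition4p1 (suc r) t _ _ _ (s≤s _) μ = coeff-vrt r t μ
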